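{- Let $G$ be an abelian group. 1. Let $G_0=\{e_0,\dots,e_r,-e_0,\dots,-e_r\}\subset G$, where $e_1,\dots,e_r\in G$ are independent and $e_0=k_1e_1+\dots+k_re_r$ with $k_i\in\mathbb N$ and $2k_i\le\operatorname{ord}(e_i)$ for all $i\in[1,r]$. If $\sum_{i=1}^r k_i\ne 1$, then $\daleth(G_0)\ge k_1+\dots+k_r+1$. 2. Let $G_0=\{ -e,e\}\subset G$ with $3\le\operatorname{ord}(e)<\infty$. Then $\daleth(G_0)\ge\operatorname{ord}(e)$. 3. Let $G=C_{n_1}\oplus\dots\oplus C_{n_r}$ with $|G|\ge 3$ and $1<n_1\mid\dots\mid n_r$, and let $(e_1,\dots,e_r)$ be a basis of $G$ with $\operatorname{ord}(e_i)=n_i$ for all $i$. If $\{e_0,\dots,e_r,-e_0,\dots,-e_r\}\subset G_0\subset G$ where $e_0=\sum_{i=1}^r\lfloor n_i/2\rfloor e_i$, then $\daleth(G_0)\ge\max\{n_r,\ 1+\sum_{i=1}^r\lfloor n_i/2\rfloor\}$.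
   Context: A family of nonzero elements $(e_i)$ of $G$ is independent if $\sum m_ie_i=0$ with $m_i\in\mathbb Z$ implies $m_ie_i=0$ for all $i$; a basis is an independent family generating $G$. For $G_0\subset G$, $\mathcal F(G_0)$ is the free abelian monoid on $G_0$ (its elements are called sequences), and $\mathcal B(G_0)=\{S\in\mathcal F(G_0):\sigma(S)=0\}$, where $\sigma(S)$ is the sum of the terms of $S$; $\mathcal B(G_0)$ is a monoid whose atoms are the minimal zero-sum sequences. For atoms $u,v$ of an atomic monoid $H$, $\mathsf L(uv)$ is the set of lengths of factorizations of $uv$ into atoms, and $\daleth(H)=\sup\{\min(\mathsf L(uv)\setminus\{2\})\mid u,v\in\mathcal A(H)\}$ with $\min\emptyset=\sup\emptyset=0$. We write $\daleth(G_0)=\daleth(\mathcal B(G_0))$. -}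

module Defs where

open import Level using (Level; _⊔_)
open import Algebra.Bundles using (AbelianGroup)
open import Data.Nat using (ℕ; zero; suc; _≤_; _<_; _+_)
open import Data.Integer using (ℤ; +_; -[1+_])
open import Data.Fin using (Fin; zero; suc)
open import Data.List using (List; []; _∷_; _++_; length; concat; foldr)
open import Data.List.Relation.Unary.All using (All)
open import Data.Product using (Σ; ∃; _×_; _,_)
open import Data.Sum using (_⊎_)
open import Relation.Nullary using (¬_)
open import Relation.Unary using (Pred)
open import Relation.Binary.PropositionalEquality using (_≡_; _≢_)
import Data.List.Relation.Binary.Permutation.Setoid as Perm

∑ℕ : (r : ℕ) → (Fin r → ℕ) → ℕ
∑ℕ zero f = 0
∑ℕ (suc r) f = f zero + ∑ℕ r (λ i → f (suc i))

-- Everything below takes the abelian group G (written multiplicatively in the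
-- stdlib record: _∙_ is the group operation "+", ε is 0, _⁻¹ is negation).
module _ {c ℓ} (G : AbelianGroup c ℓ) where
  open AbelianGroup G
  open Perm setoid using (_↭_)

  mul : ℕ → Carrier → Carrier
  mul zero x = ε
  mul (suc n) x = x ∙ mul n x

  zmul : ℤ → Carrier → Carrier
  zmul (+ n) x = mul n x
  zmul -[1+ n ] x = (mul (suc n) x) ⁻¹

  ∑ : (r : ℕ) → (Fin r → Carrier) → Carrier
  ∑ zero f = ε
  ∑ (suc r) f = f zero ∙ ∑ r (λ i → f (suc i))

  -- ord(x) = n  (n a positive integer); ord(x) = ∞ iff no such n exists
  IsOrder : Carrier → ℕ → Set ℓ
  IsOrder x n = 1 ≤ n × mul n x ≈ ε × (∀ m → 1 ≤ m → m < n → ¬ (mul m x ≈ ε))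

  Independent : (r : ℕ) → (Fin r → Carrier) → Set ℓ
  Independent r e =
    (∀ i → ¬ (e i ≈ ε)) ×
    (∀ (m : Fin r → ℤ) → ∑ r (λ i → zmul (m i) (e i)) ≈ ε →
       ∀ i → zmul (m i) (e i) ≈ ε)

  Generates : (r : ℕ) → (Fin r → Carrier) → Set (c ⊔ ℓ)
  Generates r e = ∀ g → ∃ λ (m : Fin r → ℤ) → g ≈ ∑ r (λ i → zmul (m i) (e i))

  IsBasis : (r : ℕ) → (Fin r → Carrier) → Set (c ⊔ ℓ)
  IsBasis r e = Independent r e × Generates r e

  AtLeast3Elements : Set (c ⊔ ℓ)
  AtLeast3Elements = ∃ λ x → ∃ λ y → ∃ λ z →
    ¬ (x ≈ y) × ¬ (x ≈ z) × ¬ (y ≈ z)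

  PMSet : (r : ℕ) → Carrier → (Fin r → Carrier) → Pred Carrier ℓ
  PMSet r e₀ e x = x ≈ e₀ ⊎ x ≈ e₀ ⁻¹ ⊎ ∃ λ i → x ≈ e i ⊎ x ≈ (e i) ⁻¹

  -- sequences: elements of the free abelian monoid, represented by lists,
  -- equal up to permutation (and ≈ of terms), i.e. the relation _↭_.
  Seq : Set c
  Seq = List Carrier

  σ : Seq → Carrier
  σ = foldr _∙_ ε

  module _ {p} (G₀ : Pred Carrier p) where

    InB : Seq → Set (c ⊔ ℓ ⊔ p)
    InB S = All G₀ S × σ S ≈ ε

    -- S is an atom of B(G₀) (the only unit of B(G₀) is the empty sequence)
    IsAtom : Seq → Set (c ⊔ ℓ ⊔ p)
    IsAtom S = InB S × S ≢ [] ×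
      (∀ T U → InB T → InB U → S ↭ (T ++ U) → T ≡ [] ⊎ U ≡ [])

    IsFactorization : Seq → List Seq → Set (c ⊔ ℓ ⊔ p)
    IsFactorization S fs = All IsAtom fs × concat fs ↭ S

    InL : Seq → ℕ → Set (c ⊔ ℓ ⊔ p)
    InL S n = ∃ λ fs → IsFactorization S fs × length fs ≡ n

    -- min(L(S) ∖ {2}) ≥ m, with min ∅ = 0
    MinL∖2≥ : Seq → ℕ → Set (c ⊔ ℓ ⊔ p)
    MinL∖2≥ S m = m ≡ 0 ⊎
      ((∃ λ l → InL S l × l ≢ 2) × (∀ l → InL S l → l ≢ 2 → m ≤ l))

    -- ℸ(G₀) ≥ m, where ℸ(G₀) = sup{ min(L(uv)∖{2}) | u,v atoms } ∈ ℕ ∪ {∞}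
    -- (sup ∅ = 0).  For a supremum of natural numbers, sup ≥ m iff m = 0 or
    -- some member is ≥ m.
    DalethGE : ℕ → Set (c ⊔ ℓ ⊔ p)
    DalethGE m = m ≡ 0 ⊎
      (∃ λ u → ∃ λ v → IsAtom u × IsAtom v × MinL∖2≥ (u ++ v) m)

module Submission where

-- Each bound m is witnessed by two atoms u, v of B(G₀) such that uv is a
-- product of m "pairs" g(-g), while every factorization of uv has length 2
-- or at least m (daleth-criterion, factorization-lengths in module Words):
--   Part 2 (CyclicPart):    u = eⁿ, v = (-e)ⁿ with n = ord(e) ≥ 3;
--   Part 1 (PlusMinusPart): u = (-e₀) ∏ eᵢ^{kᵢ}, v = e₀ ∏ (-eᵢ)^{kᵢ}, m = 1 + ∑ kᵢ;
--   Part 3 (BasisPart):     Part 2 for e_r, or Part 1 with kᵢ = ⌊nᵢ/2⌋.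

open import Defs
open import Algebra.Bundles using (AbelianGroup)
open import Data.Nat using (ℕ; suc; _≤_; _<_; _+_; _*_; _⊔_; _/_)
open import Data.Nat.Divisibility using (_∣_)
open import Data.Fin as Fin using (Fin; fromℕ)
open import Data.Product using (_×_)
open import Data.Sum using (_⊎_)
open import Relation.Unary using (Pred)
open import Relation.Binary.Definitions using (_Respects_)
open import Relation.Binary.PropositionalEquality using (_≢_)

import Level
open import Data.Bool using (Bool; true; false; not; _∧_; if_then_else_)
open import Data.Nat using (zero; _∸_; z≤n; s≤s; _≟_; _≤?_)
import Data.Nat.Properties as ℕₚ
import Data.Bool.Properties as BoolP
import Data.Nat.DivMod as ℕ÷
open import Data.Nat.Induction using (<-rec)
open import Data.Nat.ListAction using (sum)
open import Data.Nat.ListAction.Properties using (sum-↭)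
open import Data.Nat.Tactic.RingSolver using (solve-∀)
open import Data.Integer as ℤ using (_⊖_)
import Data.Integer.Properties as ℤₚ
open import Data.Fin using (zero; suc)
import Data.Fin.Properties as Finₚ
open import Data.List using (List; []; _∷_; _++_; length; concat; map; replicate)
import Data.List.Properties as Listₚ
open import Data.List.Relation.Unary.All as All using (All; []; _∷_)
import Data.List.Relation.Unary.All.Properties as Allₚ
open import Data.List.Relation.Binary.Pointwise using (Pointwise; []; _∷_)
import Data.List.Relation.Binary.Permutation.Propositional as Perm
open Perm using (_↭_; prep; swap; ↭-refl; ↭-sym; ↭-trans)
import Data.List.Relation.Binary.Permutation.Propositional.Properties as Permₚ
import Data.List.Relation.Binary.Permutation.Setoid as SetoidPerm
import Data.List.Relation.Binary.Permutation.Setoid.Properties as SetoidPermₚ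
open import Data.Product using (Σ; ∃; ∃₂; _,_; proj₁; proj₂)
open import Data.Sum using (inj₁; inj₂; [_,_]′)
open import Data.Empty using (⊥; ⊥-elim)
open import Function using (_∘_)
open import Relation.Nullary using (¬_; Dec; yes; no)
open import Relation.Unary using (Decidable)
import Relation.Binary.PropositionalEquality as ≡
open ≡ using (_≡_)

_==ᴮ_ : Bool → Bool → Bool
true ==ᴮ b = b
false ==ᴮ b = not b

==ᴮ-refl : ∀ b → (b ==ᴮ b) ≡ true
==ᴮ-refl true = ≡.refl
==ᴮ-refl false = ≡.refl

==ᴮ-sound : ∀ a b → (a ==ᴮ b) ≡ true → a ≡ b
==ᴮ-sound true true _ = ≡.refl
==ᴮ-sound false false _ = ≡.refl

_==ᶠ_ : ∀ {m} → Fin m → Fin m → Bool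
zero ==ᶠ zero = true
zero ==ᶠ suc _ = false
suc _ ==ᶠ zero = false
suc i ==ᶠ suc j = i ==ᶠ j

==ᶠ-refl : ∀ {m} (i : Fin m) → (i ==ᶠ i) ≡ true
==ᶠ-refl zero = ≡.refl
==ᶠ-refl (suc i) = ==ᶠ-refl i

==ᶠ-sound : ∀ {m} (i j : Fin m) → (i ==ᶠ j) ≡ true → i ≡ j
==ᶠ-sound zero zero _ = ≡.refl
==ᶠ-sound (suc i) (suc j) h = ≡.cong suc (==ᶠ-sound i j h)

δᶠ : ∀ {m} → Fin m → Fin m → ℕ
δᶠ i j = if i ==ᶠ j then 1 else 0

module GroupArithmetic {c ℓ} (G : AbelianGroup c ℓ) where
  open AbelianGroup G
  open import Algebra.Properties.AbelianGroup G
  open import Algebra.Properties.CommutativeSemigroup commutativeSemigroup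
    using (interchange)
  open import Relation.Binary.Reasoning.Setoid setoid

  mul-≡ : ∀ {a b} x → a ≡ b → mul G a x ≈ mul G b x
  mul-≡ x ≡.refl = refl

  mul-+ : ∀ a b x → mul G (a + b) x ≈ mul G a x ∙ mul G b x
  mul-+ zero b x = sym (identityˡ _)
  mul-+ (suc a) b x = trans (∙-congˡ (mul-+ a b x)) (sym (assoc _ _ _))

  mul-⁻¹ : ∀ a x → mul G a (x ⁻¹) ≈ (mul G a x) ⁻¹
  mul-⁻¹ zero x = sym ε⁻¹≈ε
  mul-⁻¹ (suc a) x = trans (∙-congˡ (mul-⁻¹ a x)) (⁻¹-∙-comm _ _)

  mul-cancel : ∀ b d x → mul G (b + d) x ≈ mul G b x → mul G d x ≈ ε
  mul-cancel zero d x h = h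
  mul-cancel (suc b) d x h = mul-cancel b d x (∙-cancelˡ x _ _ h)

  x∙ε⁻¹≈x : ∀ x → x ∙ ε ⁻¹ ≈ x
  x∙ε⁻¹≈x x = trans (∙-congˡ ε⁻¹≈ε) (identityʳ x)

  x⁻¹≈ε⇒x≈ε : ∀ {x} → x ⁻¹ ≈ ε → x ≈ ε
  x⁻¹≈ε⇒x≈ε h = ⁻¹-injective (trans h (sym ε⁻¹≈ε))

  sub-+ : ∀ a b c d x →
    (mul G a x ∙ (mul G b x) ⁻¹) ∙ (mul G c x ∙ (mul G d x) ⁻¹)
      ≈ mul G (a + c) x ∙ (mul G (b + d) x) ⁻¹
  sub-+ a b c d x = begin
    (A ∙ B ⁻¹) ∙ (C ∙ D ⁻¹)                 ≈⟨ interchange _ _ _ _ ⟩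
    (A ∙ C) ∙ (B ⁻¹ ∙ D ⁻¹)                 ≈⟨ ∙-cong (sym (mul-+ a c x)) (⁻¹-∙-comm _ _) ⟩
    mul G (a + c) x ∙ (B ∙ D) ⁻¹            ≈⟨ ∙-congˡ (⁻¹-cong (sym (mul-+ b d x))) ⟩
    mul G (a + c) x ∙ (mul G (b + d) x) ⁻¹ ∎
    where
    A B C D : Carrier
    A = mul G a x; B = mul G b x; C = mul G c x; D = mul G d x

  zmul-⊖ : ∀ a b x → zmul G (a ⊖ b) x ≈ mul G a x ∙ (mul G b x) ⁻¹
  zmul-⊖ zero zero x = sym (x∙ε⁻¹≈x ε)
  zmul-⊖ zero (suc b) x = sym (identityˡ _)
  zmul-⊖ (suc a) zero x = sym (x∙ε⁻¹≈x _)
  zmul-⊖ (suc a) (suc b) x = begin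
    zmul G (suc a ⊖ suc b) x ≈⟨ reflexive (≡.cong (λ z → zmul G z x) (ℤₚ.[1+m]⊖[1+n]≡m⊖n a b)) ⟩
    zmul G (a ⊖ b) x         ≈⟨ zmul-⊖ a b x ⟩
    A ∙ B ⁻¹                 ≈⟨ sym (identityˡ _) ⟩
    ε ∙ (A ∙ B ⁻¹)           ≈⟨ ∙-congʳ (sym (inverseʳ x)) ⟩
    (x ∙ x ⁻¹) ∙ (A ∙ B ⁻¹)  ≈⟨ interchange _ _ _ _ ⟩
    (x ∙ A) ∙ (x ⁻¹ ∙ B ⁻¹)  ≈⟨ ∙-congˡ (⁻¹-∙-comm _ _) ⟩
    (x ∙ A) ∙ (x ∙ B) ⁻¹     ∎
    where
    A B : Carrier
    A = mul G a x; B = mul G b x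

  ∑-cong : ∀ r {f g : Fin r → Carrier} → (∀ i → f i ≈ g i) → ∑ G r f ≈ ∑ G r g
  ∑-cong zero h = refl
  ∑-cong (suc r) h = ∙-cong (h zero) (∑-cong r (h ∘ suc))

  ∑-ε : ∀ r {f : Fin r → Carrier} → (∀ i → f i ≈ ε) → ∑ G r f ≈ ε
  ∑-ε zero h = refl
  ∑-ε (suc r) h = trans (∙-cong (h zero) (∑-ε r (h ∘ suc))) (identityˡ _)

  ∑-∙ : ∀ r (f g : Fin r → Carrier) → ∑ G r f ∙ ∑ G r g ≈ ∑ G r (λ i → f i ∙ g i)
  ∑-∙ zero f g = identityˡ _
  ∑-∙ (suc r) f g =
    trans (interchange _ _ _ _) (∙-congˡ (∑-∙ r (f ∘ suc) (g ∘ suc)))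

  ∑-⁻¹ : ∀ r (f : Fin r → Carrier) → ∑ G r (λ i → f i ⁻¹) ≈ (∑ G r f) ⁻¹
  ∑-⁻¹ zero f = sym ε⁻¹≈ε
  ∑-⁻¹ (suc r) f = trans (∙-congˡ (∑-⁻¹ r (f ∘ suc))) (⁻¹-∙-comm _ _)

  ∑-sub : ∀ r (f g : Fin r → Carrier) →
    ∑ G r (λ i → f i ∙ (g i) ⁻¹) ≈ ∑ G r f ∙ (∑ G r g) ⁻¹
  ∑-sub r f g = trans (sym (∑-∙ r f (λ i → g i ⁻¹))) (∙-congˡ (∑-⁻¹ r g))

  ∑-δ : ∀ m (f : Fin m → Carrier) j → ∑ G m (λ i → mul G (δᶠ i j) (f i)) ≈ f j
  ∑-δ (suc m) f zero = trans (∙-cong (identityʳ _) (∑-ε m (λ _ → refl))) (identityʳ _)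
  ∑-δ (suc m) f (suc j) = trans (identityˡ _) (∑-δ m (f ∘ suc) j)

  order-minimal : ∀ {x n} a → IsOrder G x n → 1 ≤ a → mul G a x ≈ ε → n ≤ a
  order-minimal {n = n} a (_ , _ , below) 1≤a ax with n ≤? a
  ... | yes n≤a = n≤a
  ... | no n≰a = ⊥-elim (below a 1≤a (ℕₚ.≰⇒> n≰a) ax)

  -- A lower bound b on the order of x (if any) bounds every positive
  -- annihilating multiple: the least one is the order.
  order-bound : ∀ {x b} → (∀ n → IsOrder G x n → b ≤ n) →
    ∀ c → 1 ≤ c → mul G c x ≈ ε → b ≤ c
  order-bound {x} {b} bound = <-rec (λ c → 1 ≤ c → mul G c x ≈ ε → b ≤ c) step
    where
    step : ∀ c → (∀ {m} → m < c → 1 ≤ m → mul G m x ≈ ε → b ≤ m) →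
      1 ≤ c → mul G c x ≈ ε → b ≤ c
    step c below-c 1≤c cx with b ≤? c
    ... | yes b≤c = b≤c
    ... | no b≰c = ⊥-elim (b≰c (bound c (1≤c , cx , λ m 1≤m m<c mx →
            b≰c (ℕₚ.≤-trans (below-c m<c 1≤m mx) (ℕₚ.<⇒≤ m<c)))))

  order-unique : ∀ {x a b} → IsOrder G x a → IsOrder G x b → a ≡ b
  order-unique oa@(1≤a , ax , _) ob@(1≤b , bx , _) =
    ℕₚ.≤-antisym (order-minimal _ oa 1≤b bx) (order-minimal _ ob 1≤a ax)

  order-⁻¹ : ∀ {x n} → IsOrder G x n → IsOrder G (x ⁻¹) n
  order-⁻¹ {x} {n} (1≤n , nx , below) =
    1≤n , trans (mul-⁻¹ n x) (trans (⁻¹-cong nx) ε⁻¹≈ε) ,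
    λ m 1≤m m<n mx⁻¹ → below m 1≤m m<n (x⁻¹≈ε⇒x≈ε (trans (sym (mul-⁻¹ m x)) mx⁻¹))

  multiples-of-involution : ∀ {x} → mul G 2 x ≈ ε → ∀ z → zmul G z x ≈ ε ⊎ zmul G z x ≈ x
  multiples-of-involution {x} 2x≈ε (ℤ.+ m) = natural m
    where
    natural : ∀ m → mul G m x ≈ ε ⊎ mul G m x ≈ x
    natural zero = inj₁ refl
    natural (suc m) with natural m
    ... | inj₁ mx≈ε = inj₂ (trans (∙-congˡ mx≈ε) (identityʳ x))
    ... | inj₂ mx≈x = inj₁ (trans (∙-congˡ (trans mx≈x (sym (identityʳ x)))) 2x≈ε)
  multiples-of-involution {x} 2x≈ε ℤ.-[1+ m ] with multiples-of-involution 2x≈ε (ℤ.+ suc m)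
  ... | inj₁ h = inj₁ (trans (⁻¹-cong h) ε⁻¹≈ε)
  ... | inj₂ h = inj₂ (trans (⁻¹-cong h) (sym x≈x⁻¹))
    where
    x≈x⁻¹ : x ≈ x ⁻¹
    x≈x⁻¹ = inverseˡ-unique x x (trans (∙-congˡ (sym (identityʳ x))) 2x≈ε)

  at-most-two : (e : Fin 1 → Carrier) → Generates G 1 e →
    mul G 2 (e zero) ≈ ε → ¬ AtLeast3Elements G
  at-most-two e generates 2e≈ε (x , y , z , x≉y , x≉z , y≉z) =
    distinct (zero-or-e x) (zero-or-e y) (zero-or-e z)
    where
    zero-or-e : ∀ g → g ≈ ε ⊎ g ≈ e zero
    zero-or-e g with m , g≈ ← generates g
                 with multiples-of-involution 2e≈ε (m zero)
    ... | inj₁ h = inj₁ (trans g≈ (trans (identityʳ _) h))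
    ... | inj₂ h = inj₂ (trans g≈ (trans (identityʳ _) h))
    distinct : x ≈ ε ⊎ x ≈ e zero → y ≈ ε ⊎ y ≈ e zero → z ≈ ε ⊎ z ≈ e zero → ⊥
    distinct (inj₁ a) (inj₁ b) _ = x≉y (trans a (sym b))
    distinct (inj₂ a) (inj₂ b) _ = x≉y (trans a (sym b))
    distinct (inj₁ a) _ (inj₁ b) = x≉z (trans a (sym b))
    distinct (inj₂ a) _ (inj₂ b) = x≉z (trans a (sym b))
    distinct _ (inj₁ a) (inj₁ b) = y≉z (trans a (sym b))
    distinct _ (inj₂ a) (inj₂ b) = y≉z (trans a (sym b))

module Lists where

  pick : ∀ {A : Set} {Q : A → Set} → Decidable Q → (xs : List A) →
    All (¬_ ∘ Q) xs ⊎ ∃₂ λ x rest → Q x × xs ↭ x ∷ rest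
  pick Q? [] = inj₁ []
  pick Q? (x ∷ xs) with Q? x
  ... | yes q = inj₂ (x , xs , q , ↭-refl)
  ... | no ¬q with pick Q? xs
  ...   | inj₁ none = inj₁ (¬q ∷ none)
  ...   | inj₂ (y , rest , q , p) = inj₂ (y , x ∷ rest , q , ↭-trans (prep x p) (swap x y ↭-refl))

  length-concat : ∀ {A : Set} (xss : List (List A)) → length (concat xss) ≡ sum (map length xss)
  length-concat [] = ≡.refl
  length-concat (xs ∷ xss) = ≡.trans (Listₚ.length-++ xs) (≡.cong (length xs +_) (length-concat xss))

  surplus-zero : ∀ {a b n} → a + b ≡ n → n ≤ a → b ≡ 0
  surplus-zero {a} {b} {n} a+b≡n n≤a = ℕₚ.n≤0⇒n≡0 (ℕₚ.+-cancelˡ-≤ a b 0 (begin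
    a + b ≡⟨ a+b≡n ⟩
    n     ≤⟨ n≤a ⟩
    a     ≡⟨ ℕₚ.+-identityʳ a ⟨
    a + 0 ∎))
    where open ℕₚ.≤-Reasoning

  ≤-sum : ∀ {A : Set} (f : A → ℕ) xs → All (λ x → f x ≤ sum (map f xs)) xs
  ≤-sum f [] = []
  ≤-sum f (x ∷ xs) =
    ℕₚ.m≤m+n (f x) _ ∷ All.map (λ h → ℕₚ.≤-trans h (ℕₚ.m≤n+m _ (f x))) (≤-sum f xs)

  sum-map-+ : ∀ {A : Set} (f g : A → ℕ) xs →
    sum (map (λ x → f x + g x) xs) ≡ sum (map f xs) + sum (map g xs)
  sum-map-+ f g [] = ≡.refl
  sum-map-+ f g (x ∷ xs) =
    ≡.trans (≡.cong (f x + g x +_) (sum-map-+ f g xs)) (interchange (f x) (g x) _ _)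
    where open import Algebra.Properties.CommutativeSemigroup ℕₚ.+-commutativeSemigroup
            using (interchange)

  sum-const : ∀ {A : Set} (f : A → ℕ) c xs → All (λ x → f x ≡ c) xs →
    sum (map f xs) ≡ length xs * c
  sum-const f c [] [] = ≡.refl
  sum-const f c (x ∷ xs) (fx≡c ∷ h) = ≡.cong₂ _+_ fx≡c (sum-const f c xs h)

  single-by-weight : ∀ {A : Set} (f : A → ℕ) n xs → 1 ≤ n →
    All (λ x → n ≤ f x) xs → sum (map f xs) ≡ n → length xs ≡ 1
  single-by-weight f (suc k) [] _ [] ()
  single-by-weight f n (x ∷ []) _ _ _ = ≡.refl
  single-by-weight f n (x ∷ y ∷ xs) 1≤n (n≤fx ∷ n≤fy ∷ _) total =
    ⊥-elim (ℕₚ.<-irrefl ≡.refl (ℕₚ.≤-trans n<n+n n+n≤n))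
    where
    n<n+n : n < n + n
    n<n+n = ℕₚ.m<m+n n 1≤n
    n+n≤n : n + n ≤ n
    n+n≤n = ℕₚ.≤-trans (ℕₚ.+-mono-≤ n≤fx (ℕₚ.≤-trans n≤fy (ℕₚ.m≤m+n (f y) _)))
                       (ℕₚ.≤-reflexive total)

module FinSums where

  ∑ℕ-cong : ∀ m {f g : Fin m → ℕ} → (∀ j → f j ≡ g j) → ∑ℕ m f ≡ ∑ℕ m g
  ∑ℕ-cong zero h = ≡.refl
  ∑ℕ-cong (suc m) h = ≡.cong₂ _+_ (h zero) (∑ℕ-cong m (h ∘ suc))

  ∑ℕ-zero : ∀ m {f : Fin m → ℕ} → (∀ j → f j ≡ 0) → ∑ℕ m f ≡ 0
  ∑ℕ-zero zero h = ≡.refl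
  ∑ℕ-zero (suc m) h = ≡.cong₂ _+_ (h zero) (∑ℕ-zero m (h ∘ suc))

  ∑ℕ-+ : ∀ m (f g : Fin m → ℕ) → ∑ℕ m (λ j → f j + g j) ≡ ∑ℕ m f + ∑ℕ m g
  ∑ℕ-+ zero f g = ≡.refl
  ∑ℕ-+ (suc m) f g =
    ≡.trans (≡.cong (f zero + g zero +_) (∑ℕ-+ m (f ∘ suc) (g ∘ suc)))
            (interchange (f zero) (g zero) _ _)
    where open import Algebra.Properties.CommutativeSemigroup ℕₚ.+-commutativeSemigroup
            using (interchange)

  ∑ℕ-δ : ∀ m (c : Fin m → ℕ) i → ∑ℕ m (λ j → c j * δᶠ i j) ≡ c i
  ∑ℕ-δ (suc m) c zero = ≡.trans
    (≡.cong₂ _+_ (ℕₚ.*-identityʳ (c zero)) (∑ℕ-zero m (λ j → ℕₚ.*-zeroʳ (c (suc j)))))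
    (ℕₚ.+-identityʳ _)
  ∑ℕ-δ (suc m) c (suc i) =
    ≡.trans (≡.cong (_+ ∑ℕ m (λ j → c (suc j) * δᶠ i j)) (ℕₚ.*-zeroʳ (c zero)))
            (∑ℕ-δ m (c ∘ suc) i)

  m≤∑ℕ : ∀ m (f : Fin m → ℕ) → (∀ j → 1 ≤ f j) → m ≤ ∑ℕ m f
  m≤∑ℕ zero f h = z≤n
  m≤∑ℕ (suc m) f h = ℕₚ.+-mono-≤ (h zero) (m≤∑ℕ m (f ∘ suc) (h ∘ suc))

  blocks : ∀ {A : Set} m → (Fin m → ℕ) → (Fin m → A) → List A
  blocks zero c g = []
  blocks (suc m) c g = replicate (c zero) (g zero) ++ blocks m (c ∘ suc) (g ∘ suc)

  length-blocks : ∀ {A : Set} m c (g : Fin m → A) → length (blocks m c g) ≡ ∑ℕ m c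
  length-blocks zero c g = ≡.refl
  length-blocks (suc m) c g = ≡.trans (Listₚ.length-++ (replicate (c zero) (g zero)))
    (≡.cong₂ _+_ (Listₚ.length-replicate (c zero)) (length-blocks m (c ∘ suc) (g ∘ suc)))

  all-blocks : ∀ {A : Set} {ℓ′} {Q : A → Set ℓ′} m c (g : Fin m → A) → (∀ j → Q (g j)) →
    All Q (blocks m c g)
  all-blocks zero c g h = []
  all-blocks (suc m) c g h =
    Allₚ.++⁺ (Allₚ.replicate⁺ (c zero) (h zero)) (all-blocks m (c ∘ suc) (g ∘ suc) (h ∘ suc))

-- Two words are permutations of each other iff all their
-- multiplicities agree; this turns the permutation bookkeeping of
-- factorizations into arithmetic on natural numbers.
module Multiplicity {Letter : Set} (_==_ : Letter → Letter → Bool)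
  (==-refl : ∀ a → (a == a) ≡ true)
  (==-sound : ∀ a b → (a == b) ≡ true → a ≡ b) where

  open FinSums using (blocks)
  open import Algebra.Properties.CommutativeSemigroup ℕₚ.+-commutativeSemigroup
    using (x∙yz≈y∙xz)

  δ : Letter → Letter → ℕ
  δ a b = if a == b then 1 else 0

  occ : Letter → List Letter → ℕ
  occ a [] = 0
  occ a (x ∷ w) = δ a x + occ a w

  occ-++ : ∀ a v w → occ a (v ++ w) ≡ occ a v + occ a w
  occ-++ a [] w = ≡.refl
  occ-++ a (x ∷ v) w =
    ≡.trans (≡.cong (δ a x +_) (occ-++ a v w)) (≡.sym (ℕₚ.+-assoc (δ a x) _ _))

  occ-↭ : ∀ a {v w} → v ↭ w → occ a v ≡ occ a w
  occ-↭ a Perm.refl = ≡.refl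
  occ-↭ a (prep x p) = ≡.cong (δ a x +_) (occ-↭ a p)
  occ-↭ a (swap x y p) =
    ≡.trans (≡.cong (λ n → δ a x + (δ a y + n)) (occ-↭ a p)) (x∙yz≈y∙xz (δ a x) (δ a y) _)
  occ-↭ a (Perm.trans p q) = ≡.trans (occ-↭ a p) (occ-↭ a q)

  occ-replicate : ∀ a x m → occ a (replicate m x) ≡ m * δ a x
  occ-replicate a x zero = ≡.refl
  occ-replicate a x (suc m) = ≡.cong (δ a x +_) (occ-replicate a x m)

  occ-concat : ∀ a ws → occ a (concat ws) ≡ sum (map (occ a) ws)
  occ-concat a [] = ≡.refl
  occ-concat a (w ∷ ws) = ≡.trans (occ-++ a w (concat ws)) (≡.cong (occ a w +_) (occ-concat a ws))

  occ-concat-replicate : ∀ a w m → occ a (concat (replicate m w)) ≡ m * occ a w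
  occ-concat-replicate a w zero = ≡.refl
  occ-concat-replicate a w (suc m) =
    ≡.trans (occ-++ a w _) (≡.cong (occ a w +_) (occ-concat-replicate a w m))

  occ-blocks : ∀ a m c (g : Fin m → Letter) →
    occ a (blocks m c g) ≡ ∑ℕ m (λ j → c j * δ a (g j))
  occ-blocks a zero c g = ≡.refl
  occ-blocks a (suc m) c g = ≡.trans (occ-++ a (replicate (c zero) (g zero)) _)
    (≡.cong₂ _+_ (occ-replicate a (g zero) (c zero)) (occ-blocks a m (c ∘ suc) (g ∘ suc)))

  occ-concat-blocks : ∀ a m c (g : Fin m → List Letter) →
    occ a (concat (blocks m c g)) ≡ ∑ℕ m (λ j → c j * occ a (g j))
  occ-concat-blocks a zero c g = ≡.refl
  occ-concat-blocks a (suc m) c g =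
    ≡.trans (≡.cong (occ a) (≡.sym (Listₚ.concat-++ (replicate (c zero) (g zero)) _)))
      (≡.trans (occ-++ a (concat (replicate (c zero) (g zero))) _)
        (≡.cong₂ _+_ (occ-concat-replicate a (g zero) (c zero))
                     (occ-concat-blocks a m (c ∘ suc) (g ∘ suc))))

  occ-head : ∀ x w → 1 ≤ occ x (x ∷ w)
  occ-head x w rewrite ==-refl x = s≤s z≤n

  occ-extract : ∀ a w → 1 ≤ occ a w → Σ (List Letter) λ rest → w ↭ a ∷ rest
  occ-extract a (x ∷ w) h with a == x in a==x
  ... | true rewrite ==-sound a x a==x = w , ↭-refl
  ... | false with occ-extract a w h
  ...   | rest , p = x ∷ rest , ↭-trans (prep x p) (swap x a ↭-refl)

  occ-split : ∀ a v₁ v₂ {w} → w ↭ v₁ ++ v₂ → occ a v₁ + occ a v₂ ≡ occ a w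
  occ-split a v₁ v₂ w↭ = ≡.sym (≡.trans (occ-↭ a w↭) (occ-++ a v₁ v₂))

  occ-drop : ∀ a x {w rest} → (a == x) ≡ false → w ↭ x ∷ rest → occ a rest ≡ occ a w
  occ-drop a x {rest = rest} a≠x w↭ =
    ≡.sym (≡.trans (occ-↭ a w↭) (≡.cong (λ b → (if b then 1 else 0) + occ a rest) a≠x))

  occ-empty : ∀ w → (∀ a → occ a w ≡ 0) → w ≡ []
  occ-empty [] _ = ≡.refl
  occ-empty (x ∷ w) h with ℕₚ.≤-trans (occ-head x w) (ℕₚ.≤-reflexive (h x))
  ... | ()

  occ⇒↭ : ∀ v w → (∀ a → occ a v ≡ occ a w) → v ↭ w
  occ⇒↭ [] w h = ≡.subst ([] ↭_) (≡.sym (occ-empty w (≡.sym ∘ h))) ↭-refl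
  occ⇒↭ (x ∷ v) w h
    with rest , w↭x∷rest ← occ-extract x w (ℕₚ.≤-trans (occ-head x v) (ℕₚ.≤-reflexive (h x))) =
    ↭-trans (prep x (occ⇒↭ v rest λ a →
      ℕₚ.+-cancelˡ-≡ (δ a x) _ _ (≡.trans (h a) (occ-↭ a w↭x∷rest))))
    (↭-sym w↭x∷rest)

-- A word spells a
-- sequence over G₀; atoms, factorizations and the bound ℸ(G₀) ≥ m are
-- transported from sequences (lists up to setoid permutation) to words
-- (lists of letters up to permutation), where multiplicities are available.
module Words {c ℓ p} (G : AbelianGroup c ℓ) (G₀ : Pred (AbelianGroup.Carrier G) p)
  {Letter : Set} (_==_ : Letter → Letter → Bool)
  (==-refl : ∀ a → (a == a) ≡ true)
  (==-sound : ∀ a b → (a == b) ≡ true → a ≡ b)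
  (⟦_⟧ : Letter → AbelianGroup.Carrier G) (⟦⟧∈G₀ : ∀ a → G₀ ⟦ a ⟧) where

  open AbelianGroup G
  open Multiplicity _==_ ==-refl ==-sound public
  module ≋↭ = SetoidPerm setoid
  open ≋↭ using () renaming (_↭_ to _≋↭_)

  seq : List Letter → Seq G
  seq = map ⟦_⟧

  value : List Letter → Carrier
  value w = σ G (seq w)

  value-++ : ∀ v w → value (v ++ w) ≈ value v ∙ value w
  value-++ [] w = sym (identityˡ _)
  value-++ (x ∷ v) w = trans (∙-congˡ (value-++ v w)) (sym (assoc _ _ _))

  seq-↭ : ∀ {v w} → v ↭ w → seq v ≋↭ seq w
  seq-↭ p = Perm.↭⇒↭ₛ′ isEquivalence (Permₚ.map⁺ ⟦_⟧ p)

  value-↭ : ∀ {v w} → v ↭ w → value v ≈ value w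
  value-↭ p = SetoidPermₚ.foldr-commMonoid setoid isCommutativeMonoid (seq-↭ p)

  seq-empty : ∀ {w} → seq w ≡ [] → w ≡ []
  seq-empty {[]} _ = ≡.refl

  complement-zero-sum : ∀ {w v₁ v₂} → value w ≈ ε → w ↭ v₁ ++ v₂ → value v₁ ≈ ε →
    value v₂ ≈ ε
  complement-zero-sum {w} {v₁} {v₂} w≈ε w↭ v₁≈ε = begin
    value v₂            ≈⟨ sym (identityˡ _) ⟩
    ε ∙ value v₂        ≈⟨ ∙-congʳ (sym v₁≈ε) ⟩
    value v₁ ∙ value v₂ ≈⟨ sym (value-++ v₁ v₂) ⟩
    value (v₁ ++ v₂)    ≈⟨ sym (value-↭ w↭) ⟩
    value w             ≈⟨ w≈ε ⟩
    ε                   ∎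
    where open import Relation.Binary.Reasoning.Setoid setoid

  IsWordAtom : List Letter → Set ℓ
  IsWordAtom w = value w ≈ ε × w ≢ [] ×
    (∀ v₁ v₂ → w ↭ v₁ ++ v₂ → value v₁ ≈ ε → v₁ ≡ [] ⊎ v₂ ≡ [])

  IsWordFactorization : List Letter → List (List Letter) → Set ℓ
  IsWordFactorization w ws = All IsWordAtom ws × concat ws ↭ w

  Spells : Seq G → List Letter → Set (c Level.⊔ ℓ)
  Spells = Pointwise (λ x a → x ≈ ⟦ a ⟧)

  spells-seq : ∀ w → Spells (seq w) w
  spells-seq [] = []
  spells-seq (x ∷ w) = refl ∷ spells-seq w

  spells-value : ∀ {S w} → Spells S w → σ G S ≈ value w
  spells-value [] = refl
  spells-value (x≈a ∷ s) = ∙-cong x≈a (spells-value s)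

  spells-empty : ∀ {S w} → Spells S w → w ≡ [] → S ≡ []
  spells-empty [] _ = ≡.refl

  spells-≋↭ : ∀ {S w} → Spells S w → S ≋↭ seq w
  spells-≋↭ s = ≋↭.refl (go s)
    where
    go : ∀ {S w} → Spells S w → Pointwise _≈_ S (seq w)
    go [] = []
    go (x≈a ∷ s) = x≈a ∷ go s

  spells-↭ : ∀ {S T w} → S ≋↭ T → Spells T w → ∃ λ v → Spells S v × v ↭ w
  spells-↭ (≋↭.refl S≋T) s = _ , go S≋T s , ↭-refl
    where
    go : ∀ {S T w} → Pointwise _≈_ S T → Spells T w → Spells S w
    go [] [] = []
    go (x≈y ∷ S≋T) (y≈a ∷ s) = trans x≈y y≈a ∷ go S≋T s
  spells-↭ (≋↭.prep x≈y S↭T) (y≈a ∷ s) with spells-↭ S↭T s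
  ... | v , s′ , v↭ = _ , trans x≈y y≈a ∷ s′ , prep _ v↭
  spells-↭ (≋↭.swap x≈x′ y≈y′ S↭T) (x′≈a ∷ y′≈b ∷ s) with spells-↭ S↭T s
  ... | v , s′ , v↭ = _ , trans x≈x′ y′≈b ∷ trans y≈y′ x′≈a ∷ s′ , swap _ _ v↭
  spells-↭ (≋↭.trans S↭U U↭T) s with spells-↭ U↭T s
  ... | v , s′ , v↭ with spells-↭ S↭U s′
  ...   | v′ , s″ , v′↭ = v′ , s″ , ↭-trans v′↭ v↭

  spells-++ : ∀ S {T w} → Spells (S ++ T) w →
    ∃₂ λ w₁ w₂ → w ≡ w₁ ++ w₂ × Spells S w₁ × Spells T w₂
  spells-++ [] s = [] , _ , ≡.refl , [] , s
  spells-++ (x ∷ S) (x≈a ∷ s) with spells-++ S s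
  ... | w₁ , w₂ , ≡.refl , s₁ , s₂ = _ ∷ w₁ , w₂ , ≡.refl , x≈a ∷ s₁ , s₂

  seq-all : ∀ w → All G₀ (seq w)
  seq-all [] = []
  seq-all (a ∷ w) = ⟦⟧∈G₀ a ∷ seq-all w

  atom→sequence : ∀ {w} → IsWordAtom w → IsAtom G G₀ (seq w)
  atom→sequence {w} (w≈ε , w≢[] , split) = (seq-all w , w≈ε) , w≢[] ∘ seq-empty , split′
    where
    split′ : ∀ T U → InB G G₀ T → InB G G₀ U → seq w ≋↭ T ++ U → T ≡ [] ⊎ U ≡ []
    split′ T U (_ , T≈ε) _ w↭TU with spells-↭ (≋↭.↭-sym w↭TU) (spells-seq w)
    ... | v , sv , v↭w with spells-++ T sv
    ... | w₁ , w₂ , ≡.refl , s₁ , s₂ with split w₁ w₂ (↭-sym v↭w) (trans (sym (spells-value s₁)) T≈ε)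
    ...   | inj₁ w₁≡[] = inj₁ (spells-empty s₁ w₁≡[])
    ...   | inj₂ w₂≡[] = inj₂ (spells-empty s₂ w₂≡[])

  sequence→atom : ∀ {S w} → IsAtom G G₀ S → Spells S w → IsWordAtom w
  sequence→atom {S} {w} ((_ , S≈ε) , S≢[] , split) s =
    w≈ε , (λ w≡[] → S≢[] (spells-empty s w≡[])) , split′
    where
    w≈ε : value w ≈ ε
    w≈ε = trans (sym (spells-value s)) S≈ε
    split′ : ∀ v₁ v₂ → w ↭ v₁ ++ v₂ → value v₁ ≈ ε → v₁ ≡ [] ⊎ v₂ ≡ []
    split′ v₁ v₂ w↭ v₁≈ε
      with split (seq v₁) (seq v₂) (seq-all v₁ , v₁≈ε)
                 (seq-all v₂ , complement-zero-sum {w} {v₁} {v₂} w≈ε w↭ v₁≈ε)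
                 (≋↭.↭-trans (spells-≋↭ s)
                   (≡.subst (seq w ≋↭_) (Listₚ.map-++ ⟦_⟧ v₁ v₂) (seq-↭ w↭)))
    ... | inj₁ h = inj₁ (seq-empty h)
    ... | inj₂ h = inj₂ (seq-empty h)

  atoms→words : ∀ fs {w} → All (IsAtom G G₀) fs → Spells (concat fs) w →
    ∃ λ ws → All IsWordAtom ws × concat ws ≡ w × length ws ≡ length fs
  atoms→words [] [] [] = [] , [] , ≡.refl , ≡.refl
  atoms→words (f ∷ fs) (f-atom ∷ atoms) s with spells-++ f s
  ... | w₁ , w₂ , ≡.refl , s₁ , s₂ with atoms→words fs atoms s₂
  ...   | ws , ws-atoms , ≡.refl , len =
    w₁ ∷ ws , sequence→atom f-atom s₁ ∷ ws-atoms , ≡.refl , ≡.cong suc len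

  decode-factorization : ∀ w fs → IsFactorization G G₀ (seq w) fs →
    ∃ λ ws → IsWordFactorization w ws × length ws ≡ length fs
  decode-factorization w fs (atoms , fs↭w) with spells-↭ fs↭w (spells-seq w)
  ... | v , sv , v↭w with atoms→words fs atoms sv
  ...   | ws , ws-atoms , ≡.refl , len = ws , (ws-atoms , v↭w) , len

  encode-factorization : ∀ w ws → IsWordFactorization w ws →
    IsFactorization G G₀ (seq w) (map seq ws)
  encode-factorization w ws (atoms , ws↭w) =
    Allₚ.map⁺ (All.map atom→sequence atoms) ,
    ≡.subst (_≋↭ seq w) (≡.sym (Listₚ.concat-map ws)) (seq-↭ ws↭w)

  daleth-criterion : ∀ u v m → IsWordAtom u → IsWordAtom v →
    (ws₀ : List (List Letter)) → IsWordFactorization (u ++ v) ws₀ → length ws₀ ≡ m →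
    m ≢ 2 →
    (∀ ws → IsWordFactorization (u ++ v) ws → length ws ≡ 2 ⊎ m ≤ length ws) →
    DalethGE G G₀ m
  daleth-criterion u v m u-atom v-atom ws₀ fact₀ len₀ m≢2 bound =
    inj₂ (seq u , seq v , atom→sequence u-atom , atom→sequence v-atom ,
      ≡.subst (λ S → MinL∖2≥ G G₀ S m) (Listₚ.map-++ ⟦_⟧ u v)
        (inj₂ ((m , (map seq ws₀ , encode-factorization _ ws₀ fact₀ ,
                     ≡.trans (Listₚ.length-map seq ws₀) len₀) , m≢2) ,
               minimal)))
    where
    minimal : ∀ l → InL G G₀ (seq (u ++ v)) l → l ≢ 2 → m ≤ l
    minimal l (fs , fact , ≡.refl) l≢2 with decode-factorization (u ++ v) fs fact
    ... | ws , wfact , len with bound ws wfact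
    ...   | inj₁ len≡2 = ⊥-elim (l≢2 (≡.trans (≡.sym len) len≡2))
    ...   | inj₂ m≤len = ≡.subst (m ≤_) len m≤len

  -- ws covers w if the multiplicities of the words in ws add up to those of w;
  -- this is what a factorization of w remembers about its atoms.
  Covers : List (List Letter) → List Letter → Set
  Covers ws w = ∀ a → sum (map (occ a) ws) ≡ occ a w

  factorization-covers : ∀ {w ws} → IsWordFactorization w ws → Covers ws w
  factorization-covers {ws = ws} (_ , ws↭w) a =
    ≡.trans (≡.sym (occ-concat a ws)) (occ-↭ a ws↭w)

  covers-↭ : ∀ {w ws ws′} → ws ↭ ws′ → Covers ws w → Covers ws′ w
  covers-↭ ws↭ws′ cover a = ≡.trans (≡.sym (sum-↭ (Permₚ.map⁺ (occ a) ws↭ws′))) (cover a)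

  covers-within : ∀ ws w → Covers ws w → All (λ s → ∀ a → occ a s ≤ occ a w) ws
  covers-within ws w cover = All.tabulate λ s∈ws a →
    ℕₚ.≤-trans (All.lookup (Lists.≤-sum (occ a) ws) s∈ws) (ℕₚ.≤-reflexive (cover a))

  covers-exhausted : ∀ t rest w a → Covers (t ∷ rest) w → occ a t ≡ occ a w →
    All (λ s → occ a s ≡ 0) rest
  covers-exhausted t rest w a cover t-has-all =
    All.map (λ s≤ → ℕₚ.n≤0⇒n≡0 (ℕₚ.≤-trans s≤ (ℕₚ.≤-reflexive none))) (Lists.≤-sum (occ a) rest)
    where
    none : sum (map (occ a) rest) ≡ 0
    none = Lists.surplus-zero (cover a) (ℕₚ.≤-reflexive (≡.sym t-has-all))

  pair-atom : (∀ a → ¬ (⟦ a ⟧ ≈ ε)) → ∀ x y → value (x ∷ y ∷ []) ≈ ε →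
    IsWordAtom (x ∷ y ∷ [])
  pair-atom nonzero x y xy≈ε = xy≈ε , (λ ()) , split
    where
    second-empty : ∀ v₁ v₂ → length (v₁ ++ v₂) ≡ 0 → v₂ ≡ []
    second-empty [] [] _ = ≡.refl
    split : ∀ v₁ v₂ → x ∷ y ∷ [] ↭ v₁ ++ v₂ → value v₁ ≈ ε → v₁ ≡ [] ⊎ v₂ ≡ []
    split [] v₂ _ _ = inj₁ ≡.refl
    split (z ∷ []) v₂ _ z≈ε = ⊥-elim (nonzero z (trans (sym (identityʳ _)) z≈ε))
    split (z ∷ z′ ∷ v₁) v₂ p _ =
      inj₂ (second-empty v₁ v₂ (ℕₚ.suc-injective (ℕₚ.suc-injective (≡.sym (Permₚ.↭-length p)))))

  atom-pair : ∀ {w} → IsWordAtom w → ∀ x y → (y == x) ≡ false →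
    1 ≤ occ x w → 1 ≤ occ y w → value (x ∷ y ∷ []) ≈ ε → w ↭ x ∷ y ∷ []
  atom-pair {w} (_ , _ , split) x y y≠x x∈w y∈w xy≈ε
    with rest₁ , w↭x∷rest₁ ← occ-extract x w x∈w
    with rest₂ , rest₁↭y∷rest₂ ←
           occ-extract y rest₁ (≡.subst (1 ≤_) (≡.sym (occ-drop y x y≠x w↭x∷rest₁)) y∈w)
    with split (x ∷ y ∷ []) rest₂ (↭-trans w↭x∷rest₁ (prep x rest₁↭y∷rest₂)) xy≈ε
  ... | inj₂ ≡.refl = ↭-trans w↭x∷rest₁ (prep x rest₁↭y∷rest₂)

  factorization-lengths : ∀ {w m} (Q : List Letter → Set) → Decidable Q →
    (∀ t → IsWordAtom t → ¬ Q t → length t ≡ 2) → length w ≡ m * 2 →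
    (∀ t rest → Q t → All IsWordAtom (t ∷ rest) → Covers (t ∷ rest) w → length rest ≡ 1) →
    ∀ ws → IsWordFactorization w ws → length ws ≡ 2 ⊎ m ≤ length ws
  factorization-lengths {w} {m} Q Q? pair length-w single ws fact@(atoms , ws↭w)
    with Lists.pick Q? ws
  ... | inj₁ none = inj₂ (ℕₚ.≤-reflexive (≡.sym (ℕₚ.*-cancelʳ-≡ (length ws) m 2 doubled)))
    where
    doubled : length ws * 2 ≡ m * 2
    doubled = begin
      length ws * 2                 ≡⟨ ≡.sym (Lists.sum-const length 2 ws
                                         (All.zipWith (λ (atom , ¬q) → pair _ atom ¬q) (atoms , none))) ⟩
      sum (map length ws)           ≡⟨ ≡.sym (Lists.length-concat ws) ⟩
      length (concat ws)            ≡⟨ Permₚ.↭-length ws↭w ⟩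
      length w                      ≡⟨ length-w ⟩
      m * 2                         ∎
      where open ≡.≡-Reasoning
  ... | inj₂ (t , rest , q , ws↭) =
    inj₁ (≡.trans (Permₚ.↭-length ws↭)
      (≡.cong suc (single t rest q (Permₚ.All-resp-↭ ws↭ atoms)
                    (covers-↭ {w} ws↭ (factorization-covers fact)))))

-- The atoms u = eⁿ and v = (-e)ⁿ
-- have uv = (e(-e))ⁿ.  An atom of uv using only one of the letters e, -e is
-- eⁿ or (-e)ⁿ and forces uv = u·v; every other atom is e(-e).  Hence every
-- factorization of uv has length 2 or n, and ℸ(G₀) ≥ n.
module CyclicPart {c ℓ p} (G : AbelianGroup c ℓ) (G₀ : Pred (AbelianGroup.Carrier G) p)
  (e : AbelianGroup.Carrier G) (n : ℕ) (ord-e : IsOrder G e n) (3≤n : 3 ≤ n)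
  (e∈G₀ : G₀ e) (-e∈G₀ : G₀ (AbelianGroup._⁻¹ G e)) where

  open AbelianGroup G
  open GroupArithmetic G

  ⟦_⟧ : Bool → Carrier
  ⟦ true ⟧ = e
  ⟦ false ⟧ = e ⁻¹

  ⟦⟧∈G₀ : ∀ β → G₀ ⟦ β ⟧
  ⟦⟧∈G₀ true = e∈G₀
  ⟦⟧∈G₀ false = -e∈G₀

  open Words G G₀ _==ᴮ_ ==ᴮ-refl ==ᴮ-sound ⟦_⟧ ⟦⟧∈G₀

  ⟦⟧-order : ∀ β → IsOrder G ⟦ β ⟧ n
  ⟦⟧-order true = ord-e
  ⟦⟧-order false = order-⁻¹ ord-e

  ⟦⟧-nonzero : ∀ β → ¬ (⟦ β ⟧ ≈ ε)
  ⟦⟧-nonzero β β≈ε with order-minimal 1 (⟦⟧-order β) (s≤s z≤n) (trans (identityʳ _) β≈ε)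
  ... | n≤1 = ℕₚ.<-irrefl ≡.refl (ℕₚ.≤-trans 3≤n (ℕₚ.≤-trans n≤1 (s≤s z≤n)))

  empty-word : ∀ β w → occ β w ≡ 0 → occ (not β) w ≡ 0 → w ≡ []
  empty-word true w h h′ = occ-empty w λ { true → h ; false → h′ }
  empty-word false w h h′ = occ-empty w λ { true → h′ ; false → h }

  value-pure : ∀ β w → occ (not β) w ≡ 0 → value w ≈ mul G (occ β w) ⟦ β ⟧
  value-pure β [] _ = refl
  value-pure true (true ∷ w) h = ∙-congˡ (value-pure true w h)
  value-pure false (false ∷ w) h = ∙-congˡ (value-pure false w h)

  pure-weight : ∀ β w → value w ≈ ε → w ≢ [] → occ (not β) w ≡ 0 → n ≤ occ β w
  pure-weight β w w≈ε w≢[] h with occ β w in occ≡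
  ... | zero = ⊥-elim (w≢[] (empty-word β w occ≡ h))
  ... | suc m = order-minimal (suc m) (⟦⟧-order β) (s≤s z≤n)
                  (trans (sym (mul-≡ ⟦ β ⟧ occ≡)) (trans (sym (value-pure β w h)) w≈ε))

  n≢0 : n ≢ 0
  n≢0 n≡0 with ≡.subst (3 ≤_) n≡0 3≤n
  ... | ()

  power : Bool → List Bool
  power β = replicate n β

  occ-power-same : ∀ β → occ β (power β) ≡ n
  occ-power-same true = ≡.trans (occ-replicate true true n) (ℕₚ.*-identityʳ n)
  occ-power-same false = ≡.trans (occ-replicate false false n) (ℕₚ.*-identityʳ n)

  occ-power-other : ∀ β → occ (not β) (power β) ≡ 0
  occ-power-other true = ≡.trans (occ-replicate false true n) (ℕₚ.*-zeroʳ n)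
  occ-power-other false = ≡.trans (occ-replicate true false n) (ℕₚ.*-zeroʳ n)

  power-atom : ∀ β → IsWordAtom (power β)
  power-atom β = value-zero , nonempty , split
    where
    value-zero : value (power β) ≈ ε
    value-zero = trans (value-pure β (power β) (occ-power-other β))
                       (trans (mul-≡ ⟦ β ⟧ (occ-power-same β)) (proj₁ (proj₂ (⟦⟧-order β))))
    nonempty : power β ≢ []
    nonempty h = n≢0 (≡.trans (≡.sym (Listₚ.length-replicate n)) (≡.cong length h))
    -- A nonempty zero-sum part of βⁿ consists of all n letters.
    split : ∀ v₁ v₂ → power β ↭ v₁ ++ v₂ → value v₁ ≈ ε → v₁ ≡ [] ⊎ v₂ ≡ []
    split [] v₂ _ _ = inj₁ ≡.refl
    split v₁@(_ ∷ _) v₂ p v₁≈ε = inj₂ (empty-word β v₂ no-β₂ no-other₂)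
      where
      no-other : occ (not β) v₁ + occ (not β) v₂ ≡ 0
      no-other = ≡.trans (occ-split (not β) v₁ v₂ p) (occ-power-other β)
      no-other₂ : occ (not β) v₂ ≡ 0
      no-other₂ = ℕₚ.m+n≡0⇒n≡0 (occ (not β) v₁) no-other
      no-β₂ : occ β v₂ ≡ 0
      no-β₂ = Lists.surplus-zero (≡.trans (occ-split β v₁ v₂ p) (occ-power-same β))
                (pure-weight β v₁ v₁≈ε (λ ()) (ℕₚ.m+n≡0⇒m≡0 _ no-other))

  uv : List Bool
  uv = power true ++ power false

  occ-uv : ∀ β → occ β uv ≡ n
  occ-uv true = ≡.trans (occ-++ true (power true) (power false))
    (≡.trans (≡.cong₂ _+_ (occ-power-same true) (occ-power-other false)) (ℕₚ.+-identityʳ n))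
  occ-uv false = ≡.trans (occ-++ false (power true) (power false))
    (≡.cong₂ _+_ (occ-power-other true) (occ-power-same false))

  length-uv : length uv ≡ n * 2
  length-uv = ≡.trans (Listₚ.length-++ (power true))
    (≡.trans (≡.cong₂ _+_ (Listₚ.length-replicate n) (Listₚ.length-replicate n))
      (≡.trans (≡.cong (n +_) (≡.sym (ℕₚ.+-identityʳ n))) (ℕₚ.*-comm 2 n)))

  pair : List Bool
  pair = true ∷ false ∷ []

  pair-atom′ : IsWordAtom pair
  pair-atom′ = pair-atom ⟦⟧-nonzero true false (trans (∙-congˡ (identityʳ _)) (inverseʳ e))

  pairs-factorization : IsWordFactorization uv (replicate n pair)
  pairs-factorization = Allₚ.replicate⁺ n pair-atom′ , occ⇒↭ _ uv occ-pairs
    where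
    occ-pairs : ∀ β → occ β (concat (replicate n pair)) ≡ occ β uv
    occ-pairs true = ≡.trans (occ-concat-replicate true pair n) (≡.trans (ℕₚ.*-identityʳ n) (≡.sym (occ-uv true)))
    occ-pairs false = ≡.trans (occ-concat-replicate false pair n) (≡.trans (ℕₚ.*-identityʳ n) (≡.sym (occ-uv false)))

  Pure : List Bool → Set
  Pure t = ∃ λ β → occ (not β) t ≡ 0

  pure? : Decidable Pure
  pure? t with occ false t ≟ 0 | occ true t ≟ 0
  ... | yes h | _ = yes (true , h)
  ... | no _ | yes h = yes (false , h)
  ... | no h | no h′ = no λ { (true , h″) → h h″ ; (false , h″) → h′ h″ }

  mixed-atom-is-pair : ∀ t → IsWordAtom t → ¬ Pure t → length t ≡ 2
  mixed-atom-is-pair t t-atom ¬pure = Permₚ.↭-length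
    (atom-pair t-atom true false ≡.refl (ℕₚ.n≢0⇒n>0 (¬pure ∘ (false ,_)))
      (ℕₚ.n≢0⇒n>0 (¬pure ∘ (true ,_))) (proj₁ pair-atom′))

  -- A pure atom t of a factorization t·rest of uv uses all n letters β of uv,
  -- so every atom of rest is pure in the other letter and has at least n of
  -- them; as rest has only n such letters, it is a single atom.
  pure-leaves-one : ∀ t rest → Pure t → All IsWordAtom (t ∷ rest) → Covers (t ∷ rest) uv →
    length rest ≡ 1
  pure-leaves-one t rest (β , t-pure) ((t≈ε , t≢[] , _) ∷ rest-atoms) cover =
    Lists.single-by-weight (occ (not β)) n rest (ℕₚ.≤-trans (s≤s z≤n) 3≤n)
      (All.zipWith weight (rest-atoms , covers-exhausted t rest uv β cover t-has-all)) others
    where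
    t-has-all : occ β t ≡ occ β uv
    t-has-all = ℕₚ.≤-antisym (All.head (covers-within (t ∷ rest) uv cover) β)
      (ℕₚ.≤-trans (ℕₚ.≤-reflexive (occ-uv β)) (pure-weight β t t≈ε t≢[] t-pure))
    weight : ∀ {s} → IsWordAtom s × occ β s ≡ 0 → n ≤ occ (not β) s
    weight {s} ((s≈ε , s≢[] , _) , h) =
      pure-weight (not β) s s≈ε s≢[] (≡.subst (λ b → occ b s ≡ 0) (≡.sym (BoolP.not-involutive β)) h)
    others : sum (map (occ (not β)) rest) ≡ n
    others = ≡.trans (≡.cong (_+ sum (map (occ (not β)) rest)) (≡.sym t-pure))
                     (≡.trans (cover (not β)) (occ-uv (not β)))

  daleth : DalethGE G G₀ n
  daleth = daleth-criterion (power true) (power false) n (power-atom true) (power-atom false)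
    (replicate n pair) pairs-factorization (Listₚ.length-replicate n) n≢2
    (factorization-lengths Pure pure? mixed-atom-is-pair length-uv pure-leaves-one)
    where
    n≢2 : n ≢ 2
    n≢2 n≡2 with ≡.subst (3 ≤_) n≡2 3≤n
    ... | s≤s (s≤s ())

-- The atoms
--   u = (-e₀) e₁^{k₁} ⋯ e_r^{k_r}   and   v = e₀ (-e₁)^{k₁} ⋯ (-e_r)^{k_r}
-- have uv = (e₀(-e₀)) ∏ (eᵢ(-eᵢ))^{kᵢ}, a factorization of length K + 1.  An
-- atom of uv is either a pair eᵢ(-eᵢ), or "sign-pure" (for each index only
-- one sign occurs); a sign-pure atom contains exactly one of ±e₀ and all kᵢ
-- copies of eᵢ or of -eᵢ, and then the rest of uv is a single atom.  Hence
-- every factorization of uv has length 2 or K + 1, and ℸ(G₀) ≥ K + 1.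
module PlusMinusPart {c ℓ p} (G : AbelianGroup c ℓ) (G₀ : Pred (AbelianGroup.Carrier G) p)
  (r : ℕ) (i₀ : Fin r) (e : Fin r → AbelianGroup.Carrier G) (indep : Independent G r e)
  (k : Fin r → ℕ) (1≤k : ∀ i → 1 ≤ k i)
  (2k≤ord : ∀ i n → IsOrder G (e i) n → 2 * k i ≤ n) (K≢1 : ∑ℕ r k ≢ 1)
  (±e∈G₀ : ∀ x → PMSet G r (∑ G r (λ i → mul G (k i) (e i))) e x → G₀ x) where

  open AbelianGroup G
  open GroupArithmetic G
  open FinSums

  e₀ : Carrier
  e₀ = ∑ G r (λ i → mul G (k i) (e i))

  K : ℕ
  K = ∑ℕ r k

  2k≤annihilator : ∀ i c → 1 ≤ c → mul G c (e i) ≈ ε → 2 * k i ≤ c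
  2k≤annihilator i = order-bound (2k≤ord i)

  small-annihilator : ∀ i c → c ≤ k i → mul G c (e i) ≈ ε → c ≡ 0
  small-annihilator i zero _ _ = ≡.refl
  small-annihilator i (suc c) c≤k ce≈ε = ⊥-elim (ℕₚ.<-irrefl ≡.refl (begin-strict
    k i             <⟨ ℕₚ.m<m+n (k i) (1≤k i) ⟩
    k i + k i       ≡⟨ ≡.cong (k i +_) (ℕₚ.+-identityʳ (k i)) ⟨
    2 * k i         ≤⟨ 2k≤annihilator i (suc c) (s≤s z≤n) ce≈ε ⟩
    suc c           ≤⟨ c≤k ⟩
    k i             ∎))
    where open ℕₚ.≤-Reasoning

  full-coordinate : ∀ i a b → a ≤ k i → b ≤ k i → a ≡ 0 ⊎ b ≡ 0 →
    mul G (k i + a) (e i) ≈ mul G b (e i) → a ≡ k i ⊎ b ≡ k i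
  full-coordinate i a b a≤k b≤k (inj₂ ≡.refl) h = inj₁ (ℕₚ.≤-antisym a≤k (ℕₚ.+-cancelˡ-≤ (k i) _ _
    (ℕₚ.≤-trans (ℕₚ.≤-reflexive (≡.cong (k i +_) (≡.sym (ℕₚ.+-identityʳ (k i)))))
      (2k≤annihilator i (k i + a) (ℕₚ.≤-trans (1≤k i) (ℕₚ.m≤m+n _ _)) h))))
  full-coordinate i a b a≤k b≤k (inj₁ ≡.refl) h = inj₂ (ℕₚ.≤-antisym b≤k
    (ℕₚ.m∸n≡0⇒m≤n (small-annihilator i (k i ∸ b) (ℕₚ.m∸n≤m (k i) b) d·e≈ε)))
    where
    d·e≈ε : mul G (k i ∸ b) (e i) ≈ ε
    d·e≈ε = mul-cancel b (k i ∸ b) (e i)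
      (trans (mul-≡ (e i) (≡.trans (ℕₚ.m+[n∸m]≡n b≤k) (≡.sym (ℕₚ.+-identityʳ (k i))))) h)

  Letter : Set
  Letter = Bool × Fin (suc r)

  _==_ : Letter → Letter → Bool
  (β , i) == (β′ , j) = (β ==ᴮ β′) ∧ (i ==ᶠ j)

  ==-refl : ∀ a → (a == a) ≡ true
  ==-refl (β , i) rewrite ==ᴮ-refl β = ==ᶠ-refl i

  ==-sound : ∀ a b → (a == b) ≡ true → a ≡ b
  ==-sound (β , i) (β′ , j) h with β ==ᴮ β′ in β==β′
  ... | true = ≡.cong₂ _,_ (==ᴮ-sound β β′ β==β′) (==ᶠ-sound i j h)

  ⟦_⟧ : Letter → Carrier
  ⟦ true , zero ⟧ = e₀
  ⟦ false , zero ⟧ = e₀ ⁻¹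
  ⟦ true , suc i ⟧ = e i
  ⟦ false , suc i ⟧ = e i ⁻¹

  ⟦⟧∈G₀ : ∀ a → G₀ ⟦ a ⟧
  ⟦⟧∈G₀ (true , zero) = ±e∈G₀ _ (inj₁ refl)
  ⟦⟧∈G₀ (false , zero) = ±e∈G₀ _ (inj₂ (inj₁ refl))
  ⟦⟧∈G₀ (true , suc i) = ±e∈G₀ _ (inj₂ (inj₂ (i , inj₁ refl)))
  ⟦⟧∈G₀ (false , suc i) = ±e∈G₀ _ (inj₂ (inj₂ (i , inj₂ refl)))

  open Words G G₀ _==_ ==-refl ==-sound ⟦_⟧ ⟦⟧∈G₀

  ⟦⟧-nonzero : ∀ a → ¬ (⟦ a ⟧ ≈ ε)
  ⟦⟧-nonzero (true , zero) = e₀≉ε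
    where
    e₀≉ε : ¬ (e₀ ≈ ε)
    e₀≉ε e₀≈ε with small-annihilator i₀ (k i₀) ℕₚ.≤-refl (proj₂ indep (λ i → ℤ.+ k i) e₀≈ε i₀)
    ... | k≡0 with ℕₚ.≤-trans (1≤k i₀) (ℕₚ.≤-reflexive k≡0)
    ...   | ()
  ⟦⟧-nonzero (false , zero) = ⟦⟧-nonzero (true , zero) ∘ x⁻¹≈ε⇒x≈ε
  ⟦⟧-nonzero (true , suc i) = proj₁ indep i
  ⟦⟧-nonzero (false , suc i) = proj₁ indep i ∘ x⁻¹≈ε⇒x≈ε

  -- Coordinates: the coefficient of eᵢ in the value of a word t is
  -- pos i t - neg i t, where each letter ±e₀ contributes ±kᵢ and each
  -- letter ±eᵢ contributes ±1 (counted by plus i t and minus i t).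
  plus minus : Fin r → List Letter → ℕ
  plus i t = occ (true , suc i) t
  minus i t = occ (false , suc i) t

  pos neg : Fin r → List Letter → ℕ
  pos i t = occ (true , zero) t * k i + plus i t
  neg i t = occ (false , zero) t * k i + minus i t

  coordinates : Fin r → List Letter → Carrier
  coordinates i t = mul G (pos i t) (e i) ∙ (mul G (neg i t) (e i)) ⁻¹

  letter-coordinates : ∀ a → ⟦ a ⟧ ≈ ∑ G r (λ i → coordinates i (a ∷ []))
  letter-coordinates a = trans (separate a) (sym (∑-sub r _ _))
    where
    ∑k : ∑ G r (λ i → mul G ((k i + 0) + 0) (e i)) ≈ e₀
    ∑k = ∑-cong r (λ i → mul-≡ (e i) (≡.trans (ℕₚ.+-identityʳ _) (ℕₚ.+-identityʳ (k i))))
    ∑0 : ∑ G r (λ i → mul G 0 (e i)) ≈ ε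
    ∑0 = ∑-ε r (λ _ → refl)
    ∑δ : ∀ j → ∑ G r (λ i → mul G (δᶠ i j + 0) (e i)) ≈ e j
    ∑δ j = trans (∑-cong r (λ i → mul-≡ (e i) (ℕₚ.+-identityʳ (δᶠ i j)))) (∑-δ r e j)
    separate : ∀ a → ⟦ a ⟧ ≈ ∑ G r (λ i → mul G (pos i (a ∷ [])) (e i))
                               ∙ (∑ G r (λ i → mul G (neg i (a ∷ [])) (e i))) ⁻¹
    separate (true , zero) = sym (trans (∙-cong ∑k (⁻¹-cong ∑0)) (x∙ε⁻¹≈x e₀))
    separate (false , zero) = sym (trans (∙-cong ∑0 (⁻¹-cong ∑k)) (identityˡ _))
    separate (true , suc j) = sym (trans (∙-cong (∑δ j) (⁻¹-cong ∑0)) (x∙ε⁻¹≈x _))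
    separate (false , suc j) = sym (trans (∙-cong ∑0 (⁻¹-cong (∑δ j))) (identityˡ _))

  coordinates-∷ : ∀ i a t → coordinates i (a ∷ []) ∙ coordinates i t ≈ coordinates i (a ∷ t)
  coordinates-∷ i a t =
    trans (sub-+ (pos i (a ∷ [])) (neg i (a ∷ [])) (pos i t) (neg i t) (e i))
      (∙-cong (mul-≡ (e i) (additive (δ (true , zero) a) (δ (true , suc i) a)
                                     (occ (true , zero) t) (occ (true , suc i) t) (k i)))
              (⁻¹-cong (mul-≡ (e i) (additive (δ (false , zero) a) (δ (false , suc i) a)
                                     (occ (false , zero) t) (occ (false , suc i) t) (k i)))))
    where
    additive : ∀ x y X Y κ → (x + 0) * κ + (y + 0) + (X * κ + Y) ≡ (x + X) * κ + (y + Y)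
    additive = solve-∀

  value-coordinates : ∀ t → value t ≈ ∑ G r (λ i → coordinates i t)
  value-coordinates [] = sym (∑-ε r (λ i → x∙ε⁻¹≈x ε))
  value-coordinates (a ∷ t) =
    trans (∙-cong (letter-coordinates a) (value-coordinates t))
      (trans (∑-∙ r _ _) (∑-cong r (λ i → coordinates-∷ i a t)))

  balanced : ∀ t → value t ≈ ε → ∀ i → mul G (pos i t) (e i) ≈ mul G (neg i t) (e i)
  balanced t t≈ε i = x∙y⁻¹≈ε⇒x≈y _ _
    (trans (sym (zmul-⊖ (pos i t) (neg i t) (e i)))
      (proj₂ indep (λ i → pos i t ⊖ neg i t)
        (trans (∑-cong r (λ i → zmul-⊖ (pos i t) (neg i t) (e i)))
          (trans (sym (value-coordinates t)) t≈ε)) i))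
    where open import Algebra.Properties.AbelianGroup G using (x∙y⁻¹≈ε⇒x≈y)

  block : Bool → List Letter
  block β = blocks r k (λ i → β , suc i)

  half : Bool → List Letter
  half β = (not β , zero) ∷ block β

  uv : List Letter
  uv = half true ++ half false

  occ-block-zero : ∀ b β → occ (b , zero) (block β) ≡ 0
  occ-block-zero b β = ≡.trans (occ-blocks _ r k _) (∑ℕ-zero r λ j →
    ≡.trans (≡.cong (λ x → k j * (if x then 1 else 0)) (BoolP.∧-zeroʳ (b ==ᴮ β)))
            (ℕₚ.*-zeroʳ (k j)))

  occ-block-same : ∀ β i → occ (β , suc i) (block β) ≡ k i
  occ-block-same β i = ≡.trans (occ-blocks _ r k _) (≡.trans (∑ℕ-cong r λ j →
    ≡.cong (λ x → k j * (if x ∧ (i ==ᶠ j) then 1 else 0)) (==ᴮ-refl β)) (∑ℕ-δ r k i))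

  occ-block-other : ∀ β i → occ (not β , suc i) (block β) ≡ 0
  occ-block-other β i = ≡.trans (occ-blocks _ r k _) (∑ℕ-zero r λ j →
    ≡.trans (≡.cong (λ x → k j * (if x ∧ (i ==ᶠ j) then 1 else 0)) (not==ᴮ β))
            (ℕₚ.*-zeroʳ (k j)))
    where
    not==ᴮ : ∀ β → (not β ==ᴮ β) ≡ false
    not==ᴮ true = ≡.refl
    not==ᴮ false = ≡.refl

  occ-half-zero-same : ∀ β → occ (β , zero) (half β) ≡ 0
  occ-half-zero-same true = occ-block-zero true true
  occ-half-zero-same false = occ-block-zero false false

  occ-half-zero-other : ∀ β → occ (not β , zero) (half β) ≡ 1
  occ-half-zero-other true = ≡.cong suc (occ-block-zero false true)
  occ-half-zero-other false = ≡.cong suc (occ-block-zero true false)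

  occ-half-same : ∀ β i → occ (β , suc i) (half β) ≡ k i
  occ-half-same true = occ-block-same true
  occ-half-same false = occ-block-same false

  occ-half-other : ∀ β i → occ (not β , suc i) (half β) ≡ 0
  occ-half-other true = occ-block-other true
  occ-half-other false = occ-block-other false

  occ-uv-zero : ∀ b → occ (b , zero) uv ≡ 1
  occ-uv-zero b = ≡.trans (occ-++ _ (half true) (half false)) (both b)
    where
    both : ∀ b → occ (b , zero) (half true) + occ (b , zero) (half false) ≡ 1
    both true = ≡.cong₂ _+_ (occ-half-zero-same true) (occ-half-zero-other false)
    both false = ≡.trans (≡.cong₂ _+_ (occ-half-zero-other true) (occ-half-zero-same false)) ≡.refl

  occ-uv-suc : ∀ b i → occ (b , suc i) uv ≡ k i
  occ-uv-suc b i = ≡.trans (occ-++ _ (half true) (half false)) (both b)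
    where
    both : ∀ b → occ (b , suc i) (half true) + occ (b , suc i) (half false) ≡ k i
    both true = ≡.trans (≡.cong₂ _+_ (occ-half-same true i) (occ-half-other false i)) (ℕₚ.+-identityʳ _)
    both false = ≡.cong₂ _+_ (occ-half-other true i) (occ-half-same false i)

  half⊆uv : ∀ β a → occ a (half β) ≤ occ a uv
  half⊆uv β a = ℕₚ.≤-trans (part β) (ℕₚ.≤-reflexive (≡.sym (occ-++ a (half true) (half false))))
    where
    part : ∀ β → occ a (half β) ≤ occ a (half true) + occ a (half false)
    part true = ℕₚ.m≤m+n (occ a (half true)) (occ a (half false))
    part false = ℕₚ.m≤n+m (occ a (half false)) (occ a (half true))

  Within : List Letter → Set
  Within t = ∀ a → occ a t ≤ occ a uv

  within-zero : ∀ t → Within t → ∀ b → occ (b , zero) t ≤ 1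
  within-zero t within b = ℕₚ.≤-trans (within (b , zero)) (ℕₚ.≤-reflexive (occ-uv-zero b))

  within-suc : ∀ t → Within t → ∀ b i → occ (b , suc i) t ≤ k i
  within-suc t within b i = ℕₚ.≤-trans (within (b , suc i)) (ℕₚ.≤-reflexive (occ-uv-suc b i))

  SignPure : List Letter → Set
  SignPure t = ∀ j → ∃ λ β → occ (β , j) t ≡ 0

  sign-absent? : ∀ t j → Dec (∃ λ β → occ (β , j) t ≡ 0)
  sign-absent? t j with occ (true , j) t ≟ 0 | occ (false , j) t ≟ 0
  ... | yes h | _ = yes (true , h)
  ... | no _ | yes h = yes (false , h)
  ... | no h | no h′ = no λ { (true , h″) → h h″ ; (false , h″) → h′ h″ }

  signPure? : Decidable SignPure
  signPure? t = Finₚ.all? (sign-absent? t)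

  e₀-letters : List Letter → ℕ
  e₀-letters t = occ (true , zero) t + occ (false , zero) t

  Full : List Letter → Fin r → Set
  Full t i = ∃ λ β → occ (β , suc i) t ≡ k i

  balanced-with : ∀ t {x y} → value t ≈ ε →
    occ (true , zero) t ≡ x → occ (false , zero) t ≡ y →
    ∀ i → mul G (x * k i + plus i t) (e i) ≈ mul G (y * k i + minus i t) (e i)
  balanced-with t t≈ε ≡.refl ≡.refl = balanced t t≈ε

  sign-pure-at : ∀ t → SignPure t → ∀ i → plus i t ≡ 0 ⊎ minus i t ≡ 0
  sign-pure-at t pure i with pure (suc i)
  ... | true , h = inj₁ h
  ... | false , h = inj₂ h

  -- A zero-sum sign-pure word within uv without the letters ±e₀ is empty:
  -- each of its eᵢ-coordinates is a multiple c·eᵢ = 0 with c ≤ kᵢ.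
  pure-without-e₀ : ∀ t → value t ≈ ε → Within t → SignPure t →
    occ (true , zero) t ≡ 0 → occ (false , zero) t ≡ 0 → t ≡ []
  pure-without-e₀ t t≈ε within pure no-e₀ no-−e₀ = occ-empty t absent
    where
    bal : ∀ i → mul G (plus i t) (e i) ≈ mul G (minus i t) (e i)
    bal = balanced-with t t≈ε no-e₀ no-−e₀
    absent-suc : ∀ i → plus i t ≡ 0 × minus i t ≡ 0
    absent-suc i with sign-pure-at t pure i
    ... | inj₁ p≡0 = p≡0 , small-annihilator i (minus i t) (within-suc t within false i)
                             (trans (sym (bal i)) (mul-≡ (e i) p≡0))
    ... | inj₂ q≡0 = small-annihilator i (plus i t) (within-suc t within true i)
                       (trans (bal i) (mul-≡ (e i) q≡0)) , q≡0
    absent : ∀ a → occ a t ≡ 0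
    absent (true , zero) = no-e₀
    absent (false , zero) = no-−e₀
    absent (true , suc i) = proj₁ (absent-suc i)
    absent (false , suc i) = proj₂ (absent-suc i)

  -- With (a, b) the multiplicities of
  -- (e₀, -e₀), balancing gives (a kᵢ + pᵢ)·eᵢ = (b kᵢ + qᵢ)·eᵢ where pᵢ, qᵢ ≤ kᵢ
  -- count ±eᵢ and one of them is 0: a = b = 0 forces t = [], a = b = 1
  -- contradicts purity, and otherwise full-coordinate applies.
  pure-shape : ∀ t → value t ≈ ε → t ≢ [] → Within t → SignPure t →
    e₀-letters t ≡ 1 × (∀ i → Full t i)
  pure-shape t t≈ε t≢[] within pure =
    shape (ℕₚ.n≤1⇒n≡0∨n≡1 (within-zero t within true)) (ℕₚ.n≤1⇒n≡0∨n≡1 (within-zero t within false))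
    where
    1*k : ∀ i {x} → mul G (1 * k i + x) (e i) ≈ mul G (k i + x) (e i)
    1*k i = mul-≡ (e i) (≡.cong (_+ _) (ℕₚ.+-identityʳ (k i)))
    shape : occ (true , zero) t ≡ 0 ⊎ occ (true , zero) t ≡ 1 →
            occ (false , zero) t ≡ 0 ⊎ occ (false , zero) t ≡ 1 →
            e₀-letters t ≡ 1 × (∀ i → Full t i)
    shape (inj₁ a≡0) (inj₁ b≡0) = ⊥-elim (t≢[] (pure-without-e₀ t t≈ε within pure a≡0 b≡0))
    shape (inj₂ a≡1) (inj₂ b≡1) with pure zero
    ... | true , a≡0 = ⊥-elim (ℕₚ.1+n≢0 (≡.trans (≡.sym a≡1) a≡0))
    ... | false , b≡0 = ⊥-elim (ℕₚ.1+n≢0 (≡.trans (≡.sym b≡1) b≡0))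
    shape (inj₂ a≡1) (inj₁ b≡0) = ≡.cong₂ _+_ a≡1 b≡0 , λ i →
      [ (true ,_) , (false ,_) ]′
        (full-coordinate i (plus i t) (minus i t)
          (within-suc t within true i) (within-suc t within false i) (sign-pure-at t pure i)
          (trans (sym (1*k i)) (balanced-with t t≈ε a≡1 b≡0 i)))
    shape (inj₁ a≡0) (inj₂ b≡1) = ≡.cong₂ _+_ a≡0 b≡1 , λ i →
      [ (false ,_) , (true ,_) ]′
        (full-coordinate i (minus i t) (plus i t)
          (within-suc t within false i) (within-suc t within true i)
          (Data.Sum.swap (sign-pure-at t pure i))
          (trans (sym (1*k i)) (sym (balanced-with t t≈ε a≡0 b≡1 i))))

  pure-saturates : ∀ t → value t ≈ ε → t ≢ [] → Within t → SignPure t →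
    ∀ j → ∃ λ β → occ (β , j) t ≡ occ (β , j) uv
  pure-saturates t t≈ε t≢[] within pure zero
    with ℕₚ.n≤1⇒n≡0∨n≡1 (within-zero t within true)
  ... | inj₂ one = true , ≡.trans one (≡.sym (occ-uv-zero true))
  ... | inj₁ none = false , ≡.trans (≡.trans (≡.sym (≡.cong (_+ occ (false , zero) t) none))
                                              (proj₁ (pure-shape t t≈ε t≢[] within pure)))
                                    (≡.sym (occ-uv-zero false))
  pure-saturates t t≈ε t≢[] within pure (suc i)
    with β , full ← proj₂ (pure-shape t t≈ε t≢[] within pure) i =
    β , ≡.trans full (≡.sym (occ-uv-suc β i))

  sign-cases : ∀ β b → b ≡ β ⊎ b ≡ not β
  sign-cases true true = inj₁ ≡.refl
  sign-cases true false = inj₂ ≡.refl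
  sign-cases false true = inj₂ ≡.refl
  sign-cases false false = inj₁ ≡.refl

  e₀-letters-sign : ∀ β t → e₀-letters t ≡ occ (β , zero) t + occ (not β , zero) t
  e₀-letters-sign true t = ≡.refl
  e₀-letters-sign false t = ℕₚ.+-comm (occ (true , zero) t) _

  -- half β is zero-sum: each eᵢ has coordinates kᵢ - kᵢ.
  half-value : ∀ β → value (half β) ≈ ε
  half-value β = trans (value-coordinates (half β))
    (∑-ε r λ i → trans (∙-congʳ (mul-≡ (e i) (≡.trans (pos-half β i) (≡.sym (neg-half β i)))))
                       (inverseʳ _))
    where
    1*k+0 : ∀ i → 1 * k i + 0 ≡ k i
    1*k+0 i = ≡.trans (ℕₚ.+-identityʳ _) (ℕₚ.*-identityˡ (k i))
    pos-half : ∀ β i → pos i (half β) ≡ k i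
    pos-half true i = ≡.cong₂ (λ x y → x * k i + y) (occ-half-zero-same true) (occ-half-same true i)
    pos-half false i = ≡.trans (≡.cong₂ (λ x y → x * k i + y)
      (occ-half-zero-other false) (occ-half-other false i)) (1*k+0 i)
    neg-half : ∀ β i → neg i (half β) ≡ k i
    neg-half true i = ≡.trans (≡.cong₂ (λ x y → x * k i + y)
      (occ-half-zero-other true) (occ-half-other true i)) (1*k+0 i)
    neg-half false i = ≡.cong₂ (λ x y → x * k i + y) (occ-half-zero-same false) (occ-half-same false i)

  -- A nonempty zero-sum word v within half β contains all of half β: it is
  -- sign-pure (as half β is), so it contains one of ±e₀, which must be
  -- (not β , zero), and at each index i all kᵢ letters of one sign, which
  -- must be (β , suc i).
  half-minimal : ∀ β v → value v ≈ ε → v ≢ [] → (∀ a → occ a v ≤ occ a (half β)) →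
    ∀ a → occ a (half β) ≤ occ a v
  half-minimal β v v≈ε v≢[] v≤half = contains
    where
    absent : ∀ {a} → occ a (half β) ≡ 0 → occ a v ≡ 0
    absent {a} h = ℕₚ.n≤0⇒n≡0 (ℕₚ.≤-trans (v≤half a) (ℕₚ.≤-reflexive h))
    pure : SignPure v
    pure zero = β , absent (occ-half-zero-same β)
    pure (suc i) = not β , absent (occ-half-other β i)
    shape : e₀-letters v ≡ 1 × (∀ i → Full v i)
    shape = pure-shape v v≈ε v≢[] (λ a → ℕₚ.≤-trans (v≤half a) (half⊆uv β a)) pure
    nothing : ∀ {a x} → occ a (half β) ≡ 0 → occ a (half β) ≤ x
    nothing h = ℕₚ.≤-trans (ℕₚ.≤-reflexive h) z≤n
    contains : ∀ a → occ a (half β) ≤ occ a v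
    contains (b , zero) with sign-cases β b
    ... | inj₁ ≡.refl = nothing (occ-half-zero-same β)
    ... | inj₂ ≡.refl = ℕₚ.≤-reflexive (begin
      occ (not β , zero) (half β)              ≡⟨ occ-half-zero-other β ⟩
      1                                        ≡⟨ proj₁ shape ⟨
      e₀-letters v                             ≡⟨ e₀-letters-sign β v ⟩
      occ (β , zero) v + occ (not β , zero) v  ≡⟨ ≡.cong (_+ occ (not β , zero) v)
                                                    (absent (occ-half-zero-same β)) ⟩
      occ (not β , zero) v                     ∎)
      where open ≡.≡-Reasoning
    contains (b , suc i) with sign-cases β b | proj₂ shape i
    ... | inj₂ ≡.refl | _ = nothing (occ-half-other β i)
    ... | inj₁ ≡.refl | β′ , full with sign-cases β β′
    ...   | inj₁ ≡.refl = ℕₚ.≤-reflexive (≡.trans (occ-half-same β i) (≡.sym full))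
    ...   | inj₂ ≡.refl = ⊥-elim (ℕₚ.<-irrefl ≡.refl (ℕₚ.≤-trans (1≤k i)
                            (ℕₚ.≤-reflexive (≡.trans (≡.sym full) (absent (occ-half-other β i))))))

  half-atom : ∀ β → IsWordAtom (half β)
  half-atom β = half-value β , (λ ()) , split
    where
    split : ∀ v₁ v₂ → half β ↭ v₁ ++ v₂ → value v₁ ≈ ε → v₁ ≡ [] ⊎ v₂ ≡ []
    split [] v₂ _ _ = inj₁ ≡.refl
    split v₁@(_ ∷ _) v₂ half↭ v₁≈ε = inj₂ (occ-empty v₂ λ a →
      Lists.surplus-zero (occ-split a v₁ v₂ half↭) (contained a))
      where
      contained : ∀ a → occ a (half β) ≤ occ a v₁
      contained = half-minimal β v₁ v₁≈ε (λ ()) λ a →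
        ℕₚ.m+n≤o⇒m≤o _ (ℕₚ.≤-reflexive (occ-split a v₁ v₂ half↭))

  pair : Fin (suc r) → List Letter
  pair j = (true , j) ∷ (false , j) ∷ []

  pair-value : ∀ j → value (pair j) ≈ ε
  pair-value zero = trans (∙-congˡ (identityʳ _)) (inverseʳ _)
  pair-value (suc i) = trans (∙-congˡ (identityʳ _)) (inverseʳ _)

  -- An atom that is not sign-pure contains both signs at some index, so it
  -- is a pair.
  mixed-atom-is-pair : ∀ t → IsWordAtom t → ¬ SignPure t → length t ≡ 2
  mixed-atom-is-pair t t-atom ¬pure
    with j , ¬absent ← Finₚ.¬∀⟶∃¬ (suc r) _ (sign-absent? t) ¬pure =
    Permₚ.↭-length (atom-pair t-atom (true , j) (false , j) ≡.refl
      (ℕₚ.n≢0⇒n>0 (¬absent ∘ (true ,_))) (ℕₚ.n≢0⇒n>0 (¬absent ∘ (false ,_))) (pair-value j))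

  e₀-letters-cover : ∀ ws → Covers ws uv → sum (map e₀-letters ws) ≡ 2
  e₀-letters-cover ws cover =
    ≡.trans (Lists.sum-map-+ (occ (true , zero)) (occ (false , zero)) ws)
      (≡.cong₂ _+_ (≡.trans (cover _) (occ-uv-zero true)) (≡.trans (cover _) (occ-uv-zero false)))

  -- A sign-pure atom t of a factorization t·rest of uv saturates uv at every
  -- index, so the atoms of rest are sign-pure as well and each contains one
  -- of ±e₀; as t already contains one of the two letters ±e₀ of uv, rest is
  -- a single atom.
  pure-leaves-one : ∀ t rest → SignPure t → All IsWordAtom (t ∷ rest) → Covers (t ∷ rest) uv →
    length rest ≡ 1
  pure-leaves-one t rest t-pure ((t≈ε , t≢[] , _) ∷ rest-atoms) cover =
    Lists.single-by-weight e₀-letters 1 rest (s≤s z≤n)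
      (All.zipWith weight (rest-atoms , All.zip (rest-within , rest-pure))) rest-e₀
    where
    t-within : Within t
    t-within = All.head (covers-within (t ∷ rest) uv cover)
    rest-within : All Within rest
    rest-within = All.tail (covers-within (t ∷ rest) uv cover)
    rest-pure : All SignPure rest
    rest-pure = All.tabulate λ s∈rest j →
      let β , t-has-all = pure-saturates t t≈ε t≢[] t-within t-pure j
      in β , All.lookup (covers-exhausted t rest uv (β , j) cover t-has-all) s∈rest
    weight : ∀ {s} → IsWordAtom s × Within s × SignPure s → 1 ≤ e₀-letters s
    weight {s} ((s≈ε , s≢[] , _) , within , pure) =
      ℕₚ.≤-reflexive (≡.sym (proj₁ (pure-shape s s≈ε s≢[] within pure)))
    rest-e₀ : sum (map e₀-letters rest) ≡ 1
    rest-e₀ = ℕₚ.+-cancelˡ-≡ 1 _ _ (≡.trans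
      (≡.cong (_+ sum (map e₀-letters rest)) (≡.sym (proj₁ (pure-shape t t≈ε t≢[] t-within t-pure))))
      (e₀-letters-cover (t ∷ rest) cover))

  pairs : List (List Letter)
  pairs = pair zero ∷ blocks r k (pair ∘ suc)

  length-pairs : length pairs ≡ K + 1
  length-pairs = ≡.trans (≡.cong suc (length-blocks r k (pair ∘ suc))) (ℕₚ.+-comm 1 K)

  pairs-occ : ∀ a → occ a (concat pairs) ≡ occ a uv
  pairs-occ a = begin
    occ a (concat pairs)
      ≡⟨ occ-++ a (pair zero) (concat (blocks r k (pair ∘ suc))) ⟩
    occ a (pair zero) + occ a (concat (blocks r k (pair ∘ suc)))
      ≡⟨ ≡.cong (occ a (pair zero) +_) (≡.trans (occ-concat-blocks a r k (pair ∘ suc))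
           (∑k*-+ (λ j → δ a (true , suc j)) (λ j → δ a (false , suc j)))) ⟩
    occ a (pair zero) + (∑k* (λ j → δ a (true , suc j)) + ∑k* (λ j → δ a (false , suc j)))
      ≡⟨ rearrange (δ a (true , zero)) (δ a (false , zero)) _ _ ⟩
    (δ a (false , zero) + ∑k* (λ j → δ a (true , suc j)))
      + (δ a (true , zero) + ∑k* (λ j → δ a (false , suc j)))
      ≡⟨ ≡.cong₂ (λ x y → (δ a (false , zero) + x) + (δ a (true , zero) + y))
           (occ-blocks a r k _) (occ-blocks a r k _) ⟨
    occ a (half true) + occ a (half false)
      ≡⟨ occ-++ a (half true) (half false) ⟨
    occ a uv ∎
    where
    open ≡.≡-Reasoning
    ∑k*_ : (Fin r → ℕ) → ℕ
    ∑k* x = ∑ℕ r (λ j → k j * x j)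
    ∑k*-+ : ∀ x y → ∑ℕ r (λ j → k j * (x j + (y j + 0))) ≡ ∑k* x + ∑k* y
    ∑k*-+ x y = ≡.trans (∑ℕ-cong r (λ j → distrib (k j) (x j) (y j))) (∑ℕ-+ r _ _)
      where
      distrib : ∀ κ x y → κ * (x + (y + 0)) ≡ κ * x + κ * y
      distrib = solve-∀
    rearrange : ∀ x₀ y₀ X Y → x₀ + (y₀ + 0) + (X + Y) ≡ (y₀ + X) + (x₀ + Y)
    rearrange = solve-∀

  pairs-factorization : IsWordFactorization uv pairs
  pairs-factorization =
    (pair-atom ⟦⟧-nonzero _ _ (pair-value zero) ∷
      all-blocks r k (pair ∘ suc) (λ i → pair-atom ⟦⟧-nonzero _ _ (pair-value (suc i)))) ,
    occ⇒↭ (concat pairs) uv pairs-occ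

  length-uv : length uv ≡ (K + 1) * 2
  length-uv = ≡.trans (Listₚ.length-++ (half true))
    (≡.trans (≡.cong₂ (λ x y → suc x + suc y) (length-blocks r k _) (length-blocks r k _))
             (double K))
    where
    double : ∀ K → suc K + suc K ≡ (K + 1) * 2
    double = solve-∀

  daleth : DalethGE G G₀ (K + 1)
  daleth = daleth-criterion (half true) (half false) (K + 1) (half-atom true) (half-atom false)
    pairs pairs-factorization length-pairs (K≢1 ∘ ℕₚ.suc-injective ∘ ≡.trans (ℕₚ.+-comm 1 K))
    (factorization-lengths SignPure signPure? mixed-atom-is-pair length-uv pure-leaves-one)

-- If n_r ≥ 1 + K,
-- then n_r ≥ 3 (n_r = 2 would force r = 0 and G = C₂) and Part 2 applies to
-- e_r; otherwise Part 1 applies with kᵢ = ⌊nᵢ/2⌋, as 2⌊nᵢ/2⌋ ≤ nᵢ and K ≠ 1.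
module BasisPart {c ℓ p} (G : AbelianGroup c ℓ) (G₀ : Pred (AbelianGroup.Carrier G) p)
  (r : ℕ) (n : Fin (suc r) → ℕ) (1<n : ∀ i → 1 < n i) (|G|≥3 : AtLeast3Elements G)
  (e : Fin (suc r) → AbelianGroup.Carrier G) (basis : IsBasis G (suc r) e)
  (ord-e : ∀ i → IsOrder G (e i) (n i))
  (±e∈G₀ : ∀ x → PMSet G (suc r) (∑ G (suc r) (λ i → mul G (n i / 2) (e i))) e x → G₀ x) where

  open AbelianGroup G
  open GroupArithmetic G

  K : ℕ
  K = ∑ℕ (suc r) (λ i → n i / 2)

  last : Fin (suc r)
  last = fromℕ r

  1≤half : ∀ i → 1 ≤ n i / 2
  1≤half i = ℕ÷./-monoˡ-≤ 2 (1<n i)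

  2*half≤order : ∀ i m → IsOrder G (e i) m → 2 * (n i / 2) ≤ m
  2*half≤order i m ord-m rewrite order-unique ord-m (ord-e i) =
    ℕₚ.≤-trans (ℕₚ.≤-reflexive (ℕₚ.*-comm 2 (n i / 2))) (ℕ÷.m/n*n≤m (n i) 2)

  3≤last : 1 + K ≤ n last → 3 ≤ n last
  3≤last 1+K≤n with 3 ≤? n last
  ... | yes 3≤n = 3≤n
  ... | no 3≰n = ⊥-elim (G≅C₂ r≡0)
    where
    n≤2 : n last ≤ 2
    n≤2 = ℕₚ.≤-pred (ℕₚ.≰⇒> 3≰n)
    r≡0 : r ≡ 0
    r≡0 = ℕₚ.n≤0⇒n≡0 (ℕₚ.≤-pred (ℕₚ.≤-trans (FinSums.m≤∑ℕ (suc r) _ 1≤half)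
                                   (ℕₚ.≤-pred (ℕₚ.≤-trans 1+K≤n n≤2))))
    G≅C₂ : r ≡ 0 → ⊥
    G≅C₂ ≡.refl = at-most-two e (proj₂ basis)
      (trans (mul-≡ (e zero) (ℕₚ.≤-antisym (1<n zero) n≤2)) (proj₁ (proj₂ (ord-e zero)))) |G|≥3

  daleth : DalethGE G G₀ (n last ⊔ (1 + K))
  daleth with 1 + K ≤? n last
  ... | yes 1+K≤n = ≡.subst (DalethGE G G₀) (≡.sym (ℕₚ.m≥n⇒m⊔n≡m 1+K≤n))
    (CyclicPart.daleth G G₀ (e last) (n last) (ord-e last) (3≤last 1+K≤n)
      (±e∈G₀ _ (inj₂ (inj₂ (last , inj₁ refl)))) (±e∈G₀ _ (inj₂ (inj₂ (last , inj₂ refl)))))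
  ... | no 1+K≰n = ≡.subst (DalethGE G G₀) (≡.trans (ℕₚ.+-comm K 1) (≡.sym (ℕₚ.m≤n⇒m⊔n≡n n≤1+K)))
    (PlusMinusPart.daleth G G₀ (suc r) zero e (proj₁ basis) (λ i → n i / 2) 1≤half
      2*half≤order K≢1 ±e∈G₀)
    where
    n≤1+K : n last ≤ 1 + K
    n≤1+K = ℕₚ.<⇒≤ (ℕₚ.≰⇒> 1+K≰n)
    K≢1 : K ≢ 1
    K≢1 K≡1 with ℕₚ.≤-trans (1<n last) (ℕₚ.≤-trans (ℕₚ.≤-pred (ℕₚ.≰⇒> 1+K≰n)) (ℕₚ.≤-reflexive K≡1))
    ... | s≤s ()

proposition4p1 : ∀ {c ℓ p} (G : AbelianGroup c ℓ) →
    let open AbelianGroup G in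
    -- Part 1
    ((r : ℕ) → 1 ≤ r → (e : Fin r → Carrier) → Independent G r e →
      (k : Fin r → ℕ) → (∀ i → 1 ≤ k i) →
      (∀ i n → IsOrder G (e i) n → 2 * k i ≤ n) →
      ∑ℕ r k ≢ 1 →
      DalethGE G (PMSet G r (∑ G r (λ i → mul G (k i) (e i))) e) (∑ℕ r k + 1))
    ×
    -- Part 2
    ((e : Carrier) (n : ℕ) → IsOrder G e n → 3 ≤ n →
      DalethGE G (λ x → x ≈ e ⊎ x ≈ e ⁻¹) n)
    ×
    -- Part 3 (r + 1 summands; r = 0 summands is excluded by |G| ≥ 3)
    ((r : ℕ) (n : Fin (suc r) → ℕ) → (∀ i → 1 < n i) →
      (∀ i j → i Fin.≤ j → n i ∣ n j) →
      AtLeast3Elements G →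
      (e : Fin (suc r) → Carrier) → IsBasis G (suc r) e →
      (∀ i → IsOrder G (e i) (n i)) →
      (G₀ : Pred Carrier p) → G₀ Respects _≈_ →
      (∀ x → PMSet G (suc r) (∑ G (suc r) (λ i → mul G (n i / 2) (e i))) e x → G₀ x) →
      DalethGE G G₀ (n (fromℕ r) ⊔ (1 + ∑ℕ (suc r) (λ i → n i / 2))))
proposition4p1 G =
    (λ { zero ()
       ; (suc r) _ e indep k 1≤k 2k≤ord K≢1 →
           PlusMinusPart.daleth G _ (suc r) zero e indep k 1≤k 2k≤ord K≢1 (λ _ x∈ → x∈) })
  , (λ e n ord-e 3≤n → CyclicPart.daleth G _ e n ord-e 3≤n (inj₁ refl) (inj₂ refl))
  , (λ r n 1<n _ |G|≥3 e basis ord-e G₀ _ ±e∈G₀ →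
       BasisPart.daleth G G₀ r n 1<n |G|≥3 e basis ord-e ±e∈G₀)
  where open AbelianGroup G using (refl)
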